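{- Let $H$ be a finite simple graph with $\delta(H)>|V(H)|/2$, let $G$ be a finite simple graph, and let $S$ be a minimum edge cut of $G\times H$. Unless $G=K_2$ and $H\cong\overline{K_{2l-1}}\vee lK_2$ for some positive integer $l$, one of the following holds: (i) $S$ is induced by a minimum edge cut of $G$; or (ii) $S$ is the set of all edges of $G\times H$ incident with some vertex of $G\times H$.
   Context: All graphs are finite, undirected, without loops or multiple edges. $\delta(X)$ is the minimum degree. The direct product $G\times H$ has vertex set $V(G)\times V(H)$, with $(x,u)$ adjacent to $(y,v)$ if and only if $xy\in E(G)$ and $uv\in E(H)$. A minimum edge cut of a graph is a set of edges of minimum size whose removal disconnects it. For $S_0\subseteq E(G)$, the set induced by $S_0$ is $\{(x,u)(y,v),(x,v)(y,u): xy\in S_0,\ uv\in E(H)\}\subseteq E(G\times H)$. $\overline{K_{2l-1}}\vee lK_2$ denotes the join of an edgeless graph on $2l-1$ vertices with $l$ disjoint copies of $K_2$ (equivalently, $K_{2l-1,2l}$ with a perfect matching added on the part of size $2l$). -}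

module Defs where

open import Data.Nat using (ℕ; zero; suc; _+_; _*_; _∸_; _≤_; _<_; ⌊_/2⌋)
import Data.Nat as ℕ
open import Data.Bool using (Bool; true; false; _∧_; _∨_; not; if_then_else_)
open import Data.Fin using (Fin; toℕ; remQuot)
import Data.Fin as F
open import Data.List using (List; map; allFin)
open import Data.Nat.ListAction using (sum)
open import Relation.Nullary using (yes; no)
open import Data.Empty using (⊥; ⊥-elim)
open import Data.Product using (Σ; ∃; _×_; _,_; proj₁; proj₂)
open import Relation.Nullary.Decidable using (⌊_⌋)
open import Relation.Binary.PropositionalEquality using (_≡_; refl; sym; trans; cong₂)
open import Function.Bundles using (_↔_; Inverse)

record Graph (n : ℕ) : Set where
  field
    adj    : Fin n → Fin n → Bool
    adj-sym : ∀ x y → adj x y ≡ adj y x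
    adj-irr : ∀ x → adj x x ≡ false
open Graph public

deg : ∀ {n} → Graph n → Fin n → ℕ
deg {n} G v = sum (map (λ u → if adj G v u then 1 else 0) (allFin n))

MinDegMoreThanHalf : ∀ {n} → Graph n → Set
MinDegMoreThanHalf {n} G = ∀ v → n < 2 * deg G v

-- Direct product G × H on vertex set Fin (n * m); a vertex p corresponds
-- to the pair remQuot m p = (x , u) with x ∈ V(G), u ∈ V(H).
prodAdj : ∀ {n m} → Graph n → Graph m → Fin (n * m) → Fin (n * m) → Bool
prodAdj {n} {m} G H p q =
  adj G (proj₁ (remQuot {n} m p)) (proj₁ (remQuot {n} m q)) ∧
  adj H (proj₂ (remQuot {n} m p)) (proj₂ (remQuot {n} m q))

prod-sym : ∀ {n m} (G : Graph n) (H : Graph m) p q → prodAdj G H p q ≡ prodAdj G H q p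
prod-sym {n} {m} G H p q =
  cong₂ _∧_ (adj-sym G (proj₁ (remQuot {n} m p)) (proj₁ (remQuot {n} m q)))
            (adj-sym H (proj₂ (remQuot {n} m p)) (proj₂ (remQuot {n} m q)))

prod-irr : ∀ {n m} (G : Graph n) (H : Graph m) p → prodAdj G H p p ≡ false
prod-irr {n} {m} G H p rewrite adj-irr G (proj₁ (remQuot {n} m p)) = refl

_×ᵍ_ : ∀ {n m} → Graph n → Graph m → Graph (n * m)
G ×ᵍ H = record { adj = prodAdj G H ; adj-sym = prod-sym G H ; adj-irr = prod-irr G H }

record EdgeSet {n} (G : Graph n) : Set where
  field
    mem     : Fin n → Fin n → Bool
    mem-sym : ∀ x y → mem x y ≡ mem y x
    mem-sub : ∀ x y → mem x y ≡ true → adj G x y ≡ true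
open EdgeSet public

size : ∀ {n} {G : Graph n} → EdgeSet G → ℕ
size {n} S = sum (map (λ x → sum (map (λ y →
  if (⌊ x F.<? y ⌋ ∧ mem S x y) then 1 else 0) (allFin n))) (allFin n))

data Walk {n} (A : Fin n → Fin n → Bool) : Fin n → Fin n → Set where
  here : ∀ {x} → Walk A x x
  step : ∀ {x y z} → A x y ≡ true → Walk A y z → Walk A x z

Connected : ∀ {n} → (Fin n → Fin n → Bool) → Set
Connected {n} A = ∀ (x y : Fin n) → Walk A x y

removeEdges : ∀ {n} (G : Graph n) → EdgeSet G → Fin n → Fin n → Bool
removeEdges G S x y = adj G x y ∧ not (mem S x y)

IsEdgeCut : ∀ {n} (G : Graph n) → EdgeSet G → Set
IsEdgeCut G S = Connected (removeEdges G S) → ⊥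

IsMinEdgeCut : ∀ {n} (G : Graph n) → EdgeSet G → Set
IsMinEdgeCut G S = IsEdgeCut G S × (∀ T → IsEdgeCut G T → size S ≤ size T)

InducedBy : ∀ {n m} {G : Graph n} (H : Graph m) → EdgeSet (G ×ᵍ H) → EdgeSet G → Set
InducedBy {n} {m} H S S₀ = ∀ p q → mem S p q ≡ indu (remQuot {n} m p) (remQuot {n} m q)
  where
    indu : Fin n × Fin m → Fin n × Fin m → Bool
    indu (x , u) (y , v) = mem S₀ x y ∧ adj H u v

IsStarAt : ∀ {n} (G : Graph n) → EdgeSet G → Fin n → Set
IsStarAt G S w = ∀ p q → mem S p q ≡ (adj G p q ∧ (⌊ p F.≟ w ⌋ ∨ ⌊ q F.≟ w ⌋))

_≅_ : ∀ {n m} → Graph n → Graph m → Set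
_≅_ {n} {m} G H = Σ (Fin n ↔ Fin m) λ f →
  ∀ x y → adj G x y ≡ adj H (Inverse.to f x) (Inverse.to f y)

IsK2 : ∀ {n} → Graph n → Set
IsK2 {n} G = Σ (n ≡ 2) λ _ → ∀ (x y : Fin n) → ⌊ x F.≟ y ⌋ ≡ false → adj G x y ≡ true

-- The join  \overline{K_{2l-1}} ∨ l K₂  on vertex set Fin ((2l-1) + 2l):
-- vertices with index < 2l-1 form the independent part; the remaining
-- vertices 2l-1+2i and 2l-1+2i+1 (i < l) form the matching edges.
joinAdjℕ : ℕ → ℕ → ℕ → Bool
joinAdjℕ l a b =
  not ⌊ a ℕ.≟ b ⌋ ∧
  ( (⌊ a ℕ.<? k ⌋ ∧ not ⌊ b ℕ.<? k ⌋)
  ∨ (not ⌊ a ℕ.<? k ⌋ ∧ ⌊ b ℕ.<? k ⌋)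
  ∨ (not ⌊ a ℕ.<? k ⌋ ∧ not ⌊ b ℕ.<? k ⌋ ∧ ⌊ ⌊ (a ∸ k) /2⌋ ℕ.≟ ⌊ (b ∸ k) /2⌋ ⌋))
  where k = 2 * l ∸ 1

joinAdjℕ-sym : ∀ l a b → joinAdjℕ l a b ≡ joinAdjℕ l b a
joinAdjℕ-sym l a b with a ℕ.≟ b | b ℕ.≟ a
... | yes _ | yes _ = refl
... | yes e | no ne = ⊥-elim (ne (sym e))
... | no ne | yes e = ⊥-elim (ne (sym e))
... | no _ | no _
  with a ℕ.<? (2 * l ∸ 1) | b ℕ.<? (2 * l ∸ 1)
... | yes _ | yes _ = refl
... | yes _ | no _ = refl
... | no _ | yes _ = refl
... | no _ | no _
  with ⌊ (a ∸ (2 * l ∸ 1)) /2⌋ ℕ.≟ ⌊ (b ∸ (2 * l ∸ 1)) /2⌋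
     | ⌊ (b ∸ (2 * l ∸ 1)) /2⌋ ℕ.≟ ⌊ (a ∸ (2 * l ∸ 1)) /2⌋
... | yes _ | yes _ = refl
... | yes e | no ne = ⊥-elim (ne (sym e))
... | no ne | yes e = ⊥-elim (ne (sym e))
... | no _ | no _ = refl

joinAdjℕ-irr : ∀ l a → joinAdjℕ l a a ≡ false
joinAdjℕ-irr l a with a ℕ.≟ a
... | yes _ = refl
... | no ne = ⊥-elim (ne refl)

JoinGraph : (l : ℕ) → Graph ((2 * l ∸ 1) + 2 * l)
JoinGraph l = record
  { adj = λ x y → joinAdjℕ l (toℕ x) (toℕ y)
  ; adj-sym = λ x y → joinAdjℕ-sym l (toℕ x) (toℕ y)
  ; adj-irr = λ x → joinAdjℕ-irr l (toℕ x) }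

module Submission where

-- A minimum cut S equals the boundary ∂X of a side X of G × H − S.  Over each edge
-- xy of G, ∂X contributes c(X_x, X_y) edges, where X_x ⊆ V(H) is the fibre of X
-- over x and c(A, B) counts the edges uv of H with u ∈ A xor v ∈ B.  The heart of
-- the proof is an inequality inside H: if A is mixed (neither ∅ nor V(H)) then
-- c(A, B) ≥ δ(H), and equality with B mixed forces H ≅ K̄_{2l-1} ∨ lK₂.
-- If no vertex with a neighbour has a mixed fibre, S is induced by a cut of G,
-- which is minimum because induced edge sets scale sizes by 2|E(H)|.  Otherwise the
-- star at (x, u) of size deg(x)·δ(H) forces every term to be extremal: two adjacent
-- mixed fibres give the exception (G = K₂, H the join graph), else S is a star.

open import Defs
open import Data.Nat using (ℕ; zero; suc; _+_; _*_; _∸_; _≤_; _<_; z≤n; s≤s; _≤?_; _<?_; ⌊_/2⌋)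
import Data.Nat as ℕ
open import Data.Nat.Properties
open import Data.Nat.Tactic.RingSolver using (solve-∀)
open import Data.Nat.ListAction using (sum)
open import Data.Bool using (Bool; true; false; _∧_; _∨_; not; if_then_else_; _xor_)
import Data.Bool.Properties as BP
open import Data.Fin using (Fin; toℕ; fromℕ<; remQuot; combine; _↑ˡ_; _↑ʳ_)
import Data.Fin as F
import Data.Fin.Properties as FP
open import Data.List using (map; allFin; tabulate)
open import Data.List.Properties using (map-tabulate)
open import Data.Product using (Σ; ∃; _×_; _,_; proj₁; proj₂)
open import Data.Sum using (_⊎_; inj₁; inj₂)
open import Data.Empty using (⊥; ⊥-elim)
open import Relation.Nullary using (yes; no; ¬_; Dec)
open import Relation.Nullary.Decidable using (⌊_⌋; ¬?; _×-dec_)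
open import Relation.Binary using (tri<; tri≈; tri>)
open import Relation.Binary.PropositionalEquality
open import Function using (id; case_of_)
open import Function.Bundles using (_↔_; mk↔ₛ′)

true≢false : true ≡ false → ⊥
true≢false ()

bool-cases : ∀ b → (b ≡ true) ⊎ (b ≡ false)
bool-cases true = inj₁ refl
bool-cases false = inj₂ refl

∧-elimˡ : ∀ {a b} → a ∧ b ≡ true → a ≡ true
∧-elimˡ {true} _ = refl

∧-elimʳ : ∀ {a b} → a ∧ b ≡ true → b ≡ true
∧-elimʳ {true} e = e

not-true : ∀ {b} → not b ≡ true → b ≡ false
not-true {false} _ = refl

not-false : ∀ {b} → not b ≡ false → b ≡ true
not-false {true} _ = refl

xor-false : ∀ a b → (a xor b) ≡ false → a ≡ b
xor-false true true _ = refl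
xor-false false false _ = refl

xor-true : ∀ a b → (a xor b) ≡ true → ¬ a ≡ b
xor-true true true () _
xor-true false false () _
xor-true true false _ ()
xor-true false true _ ()

xor-not : ∀ p q → (not p xor not q) ≡ (p xor q)
xor-not true q = refl
xor-not false true = refl
xor-not false false = refl

_==_ : ∀ {k} → Fin k → Fin k → Bool
a == b = ⌊ a F.≟ b ⌋

==-refl : ∀ {k} (a : Fin k) → (a == a) ≡ true
==-refl a with a F.≟ a
... | yes _ = refl
... | no ne = ⊥-elim (ne refl)

==-no : ∀ {k} (a b : Fin k) → ¬ a ≡ b → (a == b) ≡ false
==-no a b ne with a F.≟ b
... | yes e = ⊥-elim (ne e)
... | no _ = refl

b2n : Bool → ℕ
b2n true = 1
b2n false = 0

b2n≤1 : ∀ b → b2n b ≤ 1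
b2n≤1 true = s≤s z≤n
b2n≤1 false = z≤n

if-b2n : ∀ b → (if b then 1 else 0) ≡ b2n b
if-b2n true = refl
if-b2n false = refl

b2n-∧ : ∀ a b → b2n (a ∧ b) ≡ b2n a * b2n b
b2n-∧ true b = sym (+-identityʳ (b2n b))
b2n-∧ false b = refl

interchange : ∀ a b c d → a + b + (c + d) ≡ a + c + (b + d)
interchange = solve-∀

-- Finite sums over Fin k.  The sum is kept opaque so that large sums are never
-- unfolded during type checking; everything else is derived from the lemmas below.
opaque
  ∑ : ∀ {k} → (Fin k → ℕ) → ℕ
  ∑ {zero} f = 0
  ∑ {suc k} f = f F.zero + ∑ (λ i → f (F.suc i))

  ∑-suc : ∀ {k} (f : Fin (suc k) → ℕ) → ∑ f ≡ f F.zero + ∑ (λ i → f (F.suc i))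
  ∑-suc f = refl

  ∑-tabulate : ∀ {k} (f : Fin k → ℕ) → sum (tabulate f) ≡ ∑ f
  ∑-tabulate {zero} f = refl
  ∑-tabulate {suc k} f = cong (f F.zero +_) (∑-tabulate (λ i → f (F.suc i)))

  sum≡∑ : ∀ {k} (f : Fin k → ℕ) → sum (map f (allFin k)) ≡ ∑ f
  sum≡∑ {k} f = trans (cong sum (map-tabulate id f)) (∑-tabulate f)

  ∑-cong : ∀ {k} {f g : Fin k → ℕ} → (∀ i → f i ≡ g i) → ∑ f ≡ ∑ g
  ∑-cong {zero} e = refl
  ∑-cong {suc k} e = cong₂ _+_ (e F.zero) (∑-cong (λ i → e (F.suc i)))

  ∑-mono : ∀ {k} {f g : Fin k → ℕ} → (∀ i → f i ≤ g i) → ∑ f ≤ ∑ g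
  ∑-mono {zero} e = z≤n
  ∑-mono {suc k} e = +-mono-≤ (e F.zero) (∑-mono (λ i → e (F.suc i)))

  ∑-+ : ∀ {k} (f g : Fin k → ℕ) → ∑ (λ i → f i + g i) ≡ ∑ f + ∑ g
  ∑-+ {zero} f g = refl
  ∑-+ {suc k} f g rewrite ∑-+ (λ i → f (F.suc i)) (λ i → g (F.suc i)) =
    interchange (f F.zero) (g F.zero) (∑ (λ i → f (F.suc i))) (∑ (λ i → g (F.suc i)))

  ∑-*ˡ : ∀ {k} (c : ℕ) (f : Fin k → ℕ) → ∑ (λ i → c * f i) ≡ c * ∑ f
  ∑-*ˡ {zero} c f = sym (*-zeroʳ c)
  ∑-*ˡ {suc k} c f rewrite ∑-*ˡ c (λ i → f (F.suc i)) = sym (*-distribˡ-+ c (f F.zero) _)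

  ∑-zeros : ∀ {k} → ∑ {k} (λ _ → 0) ≡ 0
  ∑-zeros {zero} = refl
  ∑-zeros {suc k} = ∑-zeros {k}

  ∑-const : ∀ {k} (c : ℕ) → ∑ {k} (λ _ → c) ≡ k * c
  ∑-const {zero} c = refl
  ∑-const {suc k} c = cong (c +_) (∑-const {k} c)

  ∑-swap : ∀ {k l} (f : Fin k → Fin l → ℕ) →
    ∑ (λ i → ∑ (λ j → f i j)) ≡ ∑ (λ j → ∑ (λ i → f i j))
  ∑-swap {zero} {l} f = sym (∑-zeros {l})
  ∑-swap {suc k} {l} f = begin
      ∑ (λ j → f F.zero j) + ∑ (λ i → ∑ (λ j → f (F.suc i) j))
        ≡⟨ cong (∑ (λ j → f F.zero j) +_) (∑-swap (λ i j → f (F.suc i) j)) ⟩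
      ∑ (λ j → f F.zero j) + ∑ (λ j → ∑ (λ i → f (F.suc i) j))
        ≡⟨ sym (∑-+ (λ j → f F.zero j) (λ j → ∑ (λ i → f (F.suc i) j))) ⟩
      ∑ (λ j → f F.zero j + ∑ (λ i → f (F.suc i) j)) ∎
    where open ≡-Reasoning

  ∑-split : ∀ {a b} (f : Fin (a + b) → ℕ) →
    ∑ f ≡ ∑ (λ i → f (i ↑ˡ b)) + ∑ (λ j → f (a ↑ʳ j))
  ∑-split {zero} f = refl
  ∑-split {suc a} {b} f rewrite ∑-split {a} {b} (λ i → f (F.suc i)) =
    sym (+-assoc (f F.zero) _ _)

  ∑-combine : ∀ {n m} (f : Fin (n * m) → ℕ) →
    ∑ {n * m} f ≡ ∑ {n} (λ x → ∑ {m} (λ u → f (combine x u)))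
  ∑-combine {zero} f = refl
  ∑-combine {suc n} {m} f =
    trans (∑-split {m} {n * m} f)
      (cong (∑ (λ i → f (i ↑ˡ (n * m))) +_) (∑-combine {n} {m} (λ j → f (m ↑ʳ j))))

  ∑-delta : ∀ {k} (i : Fin k) (f : Fin k → ℕ) →
    ∑ (λ j → if j == i then f j else 0) ≡ f i
  ∑-delta {suc k} F.zero f =
    trans (cong (f F.zero +_) (trans (∑-cong {k} {g = λ _ → 0} (λ j → refl)) (∑-zeros {k}))) (+-identityʳ _)
  ∑-delta {suc k} (F.suc i) f =
    trans (∑-cong {suc k} {g = shifted} shift) (∑-delta i (λ j → f (F.suc j)))
    where
    shifted : Fin (suc k) → ℕ
    shifted F.zero = 0
    shifted (F.suc j) = if j == i then f (F.suc j) else 0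
    shift : ∀ j → (if j == F.suc i then f j else 0) ≡ shifted j
    shift F.zero = refl
    shift (F.suc j) with j F.≟ i
    ... | yes _ = refl
    ... | no _ = refl

  ∑-point : ∀ {k} (f : Fin k → ℕ) (i : Fin k) → f i ≤ ∑ f
  ∑-point f F.zero = m≤m+n _ _
  ∑-point f (F.suc i) = ≤-trans (∑-point (λ j → f (F.suc j)) i) (m≤n+m _ _)

  ∑-tight : ∀ {k} (f g : Fin k → ℕ) → (∀ i → f i ≤ g i) → ∑ g ≤ ∑ f → ∀ i → f i ≡ g i
  ∑-tight {suc k} f g le ge F.zero =
    ≤-antisym (le F.zero)
      (+-cancelʳ-≤ _ _ _ (≤-trans (+-monoʳ-≤ (g F.zero) (∑-mono (λ i → le (F.suc i)))) ge))
  ∑-tight {suc k} f g le ge (F.suc i) =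
    ∑-tight (λ j → f (F.suc j)) (λ j → g (F.suc j)) (λ j → le (F.suc j))
      (+-cancelˡ-≤ (f F.zero) _ _ (≤-trans (+-monoˡ-≤ _ (le F.zero)) ge)) i

  ∑-mono-strict : ∀ {k} (f g : Fin k → ℕ) → (∀ i → f i ≤ g i) → (q : Fin k) → f q < g q → ∑ f < ∑ g
  ∑-mono-strict f g le F.zero lt = +-mono-<-≤ lt (∑-mono (λ i → le (F.suc i)))
  ∑-mono-strict f g le (F.suc q) lt =
    +-mono-≤-< (le F.zero)
      (∑-mono-strict (λ j → f (F.suc j)) (λ j → g (F.suc j)) (λ j → le (F.suc j)) q lt)

∑-*ʳ : ∀ {k} (c : ℕ) (f : Fin k → ℕ) → ∑ (λ i → f i * c) ≡ ∑ f * c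
∑-*ʳ c f = trans (∑-cong (λ i → *-comm (f i) c)) (trans (∑-*ˡ c f) (*-comm c (∑ f)))

∑≡0⇒pointwise : ∀ {k} (f : Fin k → ℕ) → ∑ f ≡ 0 → ∀ i → f i ≡ 0
∑≡0⇒pointwise f e i = n≤0⇒n≡0 (subst (f i ≤_) e (∑-point f i))

∑-two : ∀ {k} (f : Fin k → ℕ) (i j : Fin k) → ¬ i ≡ j → f i + f j ≤ ∑ f
∑-two {suc k} f F.zero F.zero ne = ⊥-elim (ne refl)
∑-two {suc k} f F.zero (F.suc j) ne = subst (f F.zero + f (F.suc j) ≤_) (sym (∑-suc f))
  (+-monoʳ-≤ (f F.zero) (∑-point (λ i → f (F.suc i)) j))
∑-two {suc k} f (F.suc i) F.zero ne = subst (f (F.suc i) + f F.zero ≤_) (sym (∑-suc f))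
  (subst (_≤ f F.zero + ∑ (λ i → f (F.suc i))) (+-comm (f F.zero) (f (F.suc i)))
    (+-monoʳ-≤ (f F.zero) (∑-point (λ i → f (F.suc i)) i)))
∑-two {suc k} f (F.suc i) (F.suc j) ne = subst (f (F.suc i) + f (F.suc j) ≤_) (sym (∑-suc f))
  (≤-trans (∑-two (λ i → f (F.suc i)) i j (λ e → ne (cong F.suc e))) (m≤n+m _ (f F.zero)))

∑-involution : ∀ {k} (π : Fin k → Fin k) → (∀ v → π (π v) ≡ v) → (f : Fin k → ℕ) →
  ∑ (λ v → f (π v)) ≡ ∑ f
∑-involution {k} π inv f = begin
    ∑ (λ v → f (π v)) ≡⟨ ∑-cong (λ v → sym (∑-delta (π v) f)) ⟩
    ∑ (λ v → ∑ (λ w → if w == π v then f w else 0)) ≡⟨ ∑-swap _ ⟩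
    ∑ (λ w → ∑ (λ v → if w == π v then f w else 0))
      ≡⟨ ∑-cong (λ w → trans (∑-cong (λ v → flip w v)) (∑-delta (π w) (λ _ → f w))) ⟩
    ∑ f ∎
  where
  open ≡-Reasoning
  flip : ∀ w v → (if w == π v then f w else 0) ≡ (if v == π w then f w else 0)
  flip w v with w F.≟ π v | v F.≟ π w
  ... | yes _ | yes _ = refl
  ... | no _ | no _ = refl
  ... | yes e | no ne = ⊥-elim (ne (trans (sym (inv v)) (cong π (sym e))))
  ... | no ne | yes e = ⊥-elim (ne (trans (sym (inv w)) (cong π (sym e))))

count : ∀ {k} → (Fin k → Bool) → ℕ
count P = ∑ (λ i → b2n (P i))

count-full : ∀ {k} (P : Fin k → Bool) → k ≤ count P → ∀ i → P i ≡ true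
count-full {k} P le i with P i in eq
... | true = refl
... | false = ⊥-elim (<⇒≱ lt le)
  where
  lt : count P < k
  lt = subst (count P <_) (trans (∑-const {k} 1) (*-identityʳ k))
         (∑-mono-strict (λ j → b2n (P j)) (λ _ → 1) (λ j → b2n≤1 (P j)) i
            (subst (λ z → b2n z < 1) (sym eq) (s≤s z≤n)))

count-pos : ∀ {k} (A : Fin k → Bool) u → A u ≡ true → 1 ≤ count A
count-pos A u e = ≤-trans (≤-reflexive (cong b2n (sym e))) (∑-point (λ w → b2n (A w)) u)

∁ : ∀ {k} → (Fin k → Bool) → Fin k → Bool
∁ A u = not (A u)

count-∁ : ∀ {k} (A : Fin k → Bool) → count A + count (∁ A) ≡ k
count-∁ {k} A = trans (sym (∑-+ _ _)) (trans (∑-cong (λ u → one (A u))) (trans (∑-const {k} 1) (*-identityʳ k)))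
  where
  one : ∀ b → b2n b + b2n (not b) ≡ 1
  one true = refl
  one false = refl

count-singleton : ∀ {k} (u : Fin k) → count (λ w → w == u) ≡ 1
count-singleton u = trans (∑-cong (λ w → sym (if-b2n (w == u)))) (∑-delta u (λ _ → 1))

_<ᵇ_ : ∀ {k} → Fin k → Fin k → Bool
a <ᵇ b = ⌊ a F.<? b ⌋

<ᵇ-true : ∀ {k} {a b : Fin k} → a F.< b → (a <ᵇ b) ≡ true
<ᵇ-true {a = a} {b} p with a F.<? b
... | yes _ = refl
... | no n = ⊥-elim (n p)

<ᵇ-false : ∀ {k} {a b : Fin k} → ¬ a F.< b → (a <ᵇ b) ≡ false
<ᵇ-false {a = a} {b} p with a F.<? b
... | yes q = ⊥-elim (p q)
... | no _ = refl

<ᵇ-irrefl : ∀ {k} (a : Fin k) → (a <ᵇ a) ≡ false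
<ᵇ-irrefl a = <ᵇ-false (FP.<-irrefl refl)

<ᵇ-flip : ∀ {k} (a b : Fin k) → ¬ a ≡ b → (b <ᵇ a) ≡ not (a <ᵇ b)
<ᵇ-flip a b ne with FP.<-cmp a b
... | tri< p _ q = trans (<ᵇ-false q) (cong not (sym (<ᵇ-true p)))
... | tri≈ _ e _ = ⊥-elim (ne e)
... | tri> p _ q = trans (<ᵇ-true q) (cong not (sym (<ᵇ-false p)))

-- Counting edges.  `ordered M` counts the ordered pairs related by M; for an
-- edge set this is twice its size, and it is the quantity that factorises over
-- the product G × H.

deg-∑ : ∀ {n} (K : Graph n) v → deg K v ≡ ∑ (λ u → b2n (adj K v u))
deg-∑ K v = trans (sum≡∑ _) (∑-cong (λ u → if-b2n (adj K v u)))

ordered : ∀ {k} → (Fin k → Fin k → Bool) → ℕ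
ordered M = ∑ (λ p → ∑ (λ q → b2n (M p q)))

unordered : ∀ {k} → (Fin k → Fin k → Bool) → ℕ
unordered M = ∑ (λ x → ∑ (λ y → b2n ((x <ᵇ y) ∧ M x y)))

size≡unordered : ∀ {n} {K : Graph n} (S : EdgeSet K) → size S ≡ unordered (mem S)
size≡unordered S = trans (sum≡∑ _) (∑-cong (λ x → trans (sum≡∑ _) (∑-cong (λ y → if-b2n _))))

ordered≡2*unordered : ∀ {k} (M : Fin k → Fin k → Bool) → (∀ x → M x x ≡ false) →
  (∀ x y → M x y ≡ M y x) → ordered M ≡ 2 * unordered M
ordered≡2*unordered M irr symm = begin
    ordered M ≡⟨ ∑-cong (λ x → trans (∑-cong (λ y → split x y)) (∑-+ _ _)) ⟩
    ∑ (λ x → forward x + ∑ (λ y → b2n ((y <ᵇ x) ∧ M x y))) ≡⟨ ∑-+ _ _ ⟩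
    unordered M + ∑ (λ x → ∑ (λ y → b2n ((y <ᵇ x) ∧ M x y)))
      ≡⟨ cong (unordered M +_) (trans (∑-swap _)
           (∑-cong (λ y → ∑-cong (λ x → cong (λ z → b2n ((y <ᵇ x) ∧ z)) (symm x y))))) ⟩
    unordered M + unordered M ≡⟨ cong (unordered M +_) (sym (+-identityʳ _)) ⟩
    2 * unordered M ∎
  where
  open ≡-Reasoning
  forward : _ → ℕ
  forward x = ∑ (λ y → b2n ((x <ᵇ y) ∧ M x y))
  split : ∀ x y → b2n (M x y) ≡ b2n ((x <ᵇ y) ∧ M x y) + b2n ((y <ᵇ x) ∧ M x y)
  split x y with FP.<-cmp x y
  ... | tri< lt _ _ rewrite <ᵇ-true lt | <ᵇ-false (FP.<-asym lt) = sym (+-identityʳ _)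
  ... | tri> _ _ gt rewrite <ᵇ-true gt | <ᵇ-false (FP.<-asym gt) = refl
  ... | tri≈ _ refl _ rewrite <ᵇ-irrefl x | irr x = refl

edge-irr : ∀ {n} {K : Graph n} (S : EdgeSet K) → ∀ x → mem S x x ≡ false
edge-irr {K = K} S x with mem S x x in e
... | false = refl
... | true = ⊥-elim (true≢false (trans (sym (mem-sub S x x e)) (adj-irr K x)))

ordered≡2*size : ∀ {n} {K : Graph n} (S : EdgeSet K) → ordered (mem S) ≡ 2 * size S
ordered≡2*size S =
  trans (ordered≡2*unordered (mem S) (edge-irr S) (mem-sym S)) (cong (2 *_) (sym (size≡unordered S)))

ordered≤⇒size≤ : ∀ {n} {K : Graph n} (S T : EdgeSet K) → ordered (mem S) ≤ ordered (mem T) → size S ≤ size T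
ordered≤⇒size≤ S T le = *-cancelˡ-≤ 2 (subst₂ _≤_ (ordered≡2*size S) (ordered≡2*size T) le)

size≤⇒ordered≤ : ∀ {n} {K : Graph n} (S T : EdgeSet K) → size S ≤ size T → ordered (mem S) ≤ ordered (mem T)
size≤⇒ordered≤ S T le = subst₂ _≤_ (sym (ordered≡2*size S)) (sym (ordered≡2*size T)) (*-monoʳ-≤ 2 le)

ordered-combine : ∀ {n m} (g : Fin (n * m) → Fin (n * m) → ℕ) →
  ∑ (λ p → ∑ (λ q → g p q)) ≡
  ∑ {n} (λ x → ∑ {m} (λ u → ∑ {n} (λ y → ∑ {m} (λ v → g (combine x u) (combine y v)))))
ordered-combine {n} {m} g = trans (∑-combine {n} {m} _) (∑-cong (λ x → ∑-cong (λ u → ∑-combine {n} {m} _)))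

prodAdj-combine : ∀ {n m} (G : Graph n) (H : Graph m) x u y v →
  prodAdj G H (combine x u) (combine y v) ≡ adj G x y ∧ adj H u v
prodAdj-combine {n} {m} G H x u y v =
  cong₂ (λ a b → adj G (proj₁ a) (proj₁ b) ∧ adj H (proj₂ a) (proj₂ b))
    (FP.remQuot-combine {n} {m} x u) (FP.remQuot-combine {n} {m} y v)

∑-factor-edges : ∀ {n m} (a : Fin n → Fin n → Bool) (Φ : Fin n → Fin m → Fin n → Fin m → Bool) →
  ∑ (λ x → ∑ (λ u → ∑ (λ y → ∑ (λ v → b2n (a x y ∧ Φ x u y v))))) ≡
  ∑ (λ x → ∑ (λ y → b2n (a x y) * ∑ (λ u → ∑ (λ v → b2n (Φ x u y v)))))
∑-factor-edges a Φ = ∑-cong λ x → begin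
    ∑ (λ u → ∑ (λ y → ∑ (λ v → b2n (a x y ∧ Φ x u y v))))
      ≡⟨ ∑-cong (λ u → ∑-cong (λ y → trans (∑-cong (λ v → b2n-∧ (a x y) _)) (∑-*ˡ (b2n (a x y)) _))) ⟩
    ∑ (λ u → ∑ (λ y → b2n (a x y) * ∑ (λ v → b2n (Φ x u y v)))) ≡⟨ ∑-swap _ ⟩
    ∑ (λ y → ∑ (λ u → b2n (a x y) * ∑ (λ v → b2n (Φ x u y v))))
      ≡⟨ ∑-cong (λ y → ∑-*ˡ (b2n (a x y)) _) ⟩
    ∑ (λ y → b2n (a x y) * ∑ (λ u → ∑ (λ v → b2n (Φ x u y v)))) ∎
  where open ≡-Reasoning

allB : ∀ {k} → (Fin k → Bool) → Bool
allB {zero} f = true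
allB {suc k} f = f F.zero ∧ allB (λ i → f (F.suc i))

allB-true : ∀ {k} (f : Fin k → Bool) → allB f ≡ true → ∀ i → f i ≡ true
allB-true {suc k} f e i with f F.zero in eq0
allB-true {suc k} f e F.zero | true = eq0
allB-true {suc k} f e (F.suc i) | true = allB-true (λ j → f (F.suc j)) e i

allB-false : ∀ {k} (f : Fin k → Bool) → allB f ≡ false → ∃ λ i → f i ≡ false
allB-false {suc k} f e with f F.zero in eq0
... | false = F.zero , eq0
... | true with allB-false (λ j → f (F.suc j)) e
... | i , ei = F.suc i , ei

anyB : ∀ {k} → (Fin k → Bool) → Bool
anyB {zero} f = false
anyB {suc k} f = f F.zero ∨ anyB (λ i → f (F.suc i))

anyB-true : ∀ {k} (f : Fin k → Bool) → anyB f ≡ true → ∃ λ i → f i ≡ true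
anyB-true {suc k} f e with f F.zero in eq0
... | true = F.zero , eq0
... | false with anyB-true (λ j → f (F.suc j)) e
... | i , ei = F.suc i , ei

anyB-false : ∀ {k} (f : Fin k → Bool) → anyB f ≡ false → ∀ i → f i ≡ false
anyB-false {suc k} f e F.zero with f F.zero
... | false = refl
anyB-false {suc k} f () F.zero | true
anyB-false {suc k} f e (F.suc i) with f F.zero
... | false = anyB-false (λ j → f (F.suc j)) e i
anyB-false {suc k} f () (F.suc i) | true

-- A set closed under a relation R contains every walk
-- starting in it, so a closed set that is neither empty nor full witnesses that
-- R is disconnected; conversely, the reachable set of a vertex is such a set
-- whenever R is disconnected.

snoc : ∀ {k} {R : Fin k → Fin k → Bool} {x y z} → Walk R x y → R y z ≡ true → Walk R x z
snoc here r = step r here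
snoc (step r w) r' = step r (snoc w r')

walk-map : ∀ {a b} {R : Fin a → Fin a → Bool} {R' : Fin b → Fin b → Bool} (f : Fin a → Fin b) →
  (∀ p q → R p q ≡ true → R' (f p) (f q) ≡ true) → ∀ {p q} → Walk R p q → Walk R' (f p) (f q)
walk-map f h here = here
walk-map f h (step r w) = step (h _ _ r) (walk-map f h w)

Closed : ∀ {k} → (Fin k → Fin k → Bool) → (Fin k → Bool) → Set
Closed {k} R C = ∀ p q → R p q ≡ true → C p ≡ true → C q ≡ true

closed-walk : ∀ {k} {R : Fin k → Fin k → Bool} (X : Fin k → Bool) → Closed R X →
  ∀ {a b} → Walk R a b → X a ≡ true → X b ≡ true
closed-walk X cl here xa = xa
closed-walk X cl (step r w) xa = closed-walk X cl w (cl _ _ r xa)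

closed⇒disconnected : ∀ {k} (R : Fin k → Fin k → Bool) (X : Fin k → Bool) → Closed R X →
  ∀ a b → X a ≡ true → X b ≡ false → Connected R → ⊥
closed⇒disconnected R X cl a b xa xb c = true≢false (trans (sym (closed-walk X cl (c a b) xa)) xb)

module Reachability {k : ℕ} (R : Fin k → Fin k → Bool) where

  expand : (Fin k → Bool) → Fin k → Bool
  expand C q = C q ∨ anyB (λ p → C p ∧ R p q)

  isClosed : (Fin k → Bool) → Bool
  isClosed C = allB (λ p → allB (λ q → not (C p ∧ R p q) ∨ C q))

  isClosed-true : ∀ C → isClosed C ≡ true → Closed R C
  isClosed-true C e p q r cp with allB-true _ (allB-true _ e p) q
  ... | h rewrite cp | r with C q
  ... | true = refl

  isClosed-false : ∀ C → isClosed C ≡ false → ∃ λ q → expand C q ≡ true × C q ≡ false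
  isClosed-false C e with allB-false _ e
  ... | p , ep with allB-false _ ep
  ... | q , eq with C p in ecp | R p q in erq | C q in ecq
  ... | true | true | false = q , (reached , ecq)
    where
    reached : expand C q ≡ true
    reached rewrite ecq with anyB (λ p₁ → C p₁ ∧ R p₁ q) in ea
    ... | true = refl
    ... | false = ⊥-elim (true≢false (trans (sym (cong₂ _∧_ ecp erq)) (anyB-false _ ea p)))
  isClosed-false C e | p , ep | q , () | true | true | true
  isClosed-false C e | p , ep | q , () | true | false | _
  isClosed-false C e | p , ep | q , () | false | _ | _

  saturate : ℕ → (Fin k → Bool) → Fin k → Bool
  saturate zero C = C
  saturate (suc f) C = if isClosed C then C else saturate f (expand C)

  expand-⊇ : ∀ C q → C q ≡ true → expand C q ≡ true
  expand-⊇ C q e rewrite e = refl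

  saturate-⊇ : ∀ f C q → C q ≡ true → saturate f C q ≡ true
  saturate-⊇ zero C q e = e
  saturate-⊇ (suc f) C q e with isClosed C
  ... | true = e
  ... | false = saturate-⊇ f (expand C) q (expand-⊇ C q e)

  -- Each expansion of a non-closed set adds an element, so f + |C| ≥ k steps suffice.
  saturate-closed : ∀ f C → k ≤ f + count C → Closed R (saturate f C)
  saturate-closed zero C le p q r cp = count-full C le q
  saturate-closed (suc f) C le with isClosed C in e
  ... | true = isClosed-true C e
  ... | false with isClosed-false C e
  ... | q , sq , cq = saturate-closed f (expand C) le'
    where
    grows : count C < count (expand C)
    grows = ∑-mono-strict _ _ mono q (subst₂ (λ a b → b2n a < b2n b) (sym cq) (sym sq) (s≤s z≤n))
      where
      mono : ∀ i → b2n (C i) ≤ b2n (expand C i)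
      mono i with C i in ci
      ... | true = s≤s z≤n
      ... | false = z≤n
    le' : k ≤ f + count (expand C)
    le' = ≤-trans le (≤-trans (≤-reflexive (sym (+-suc f (count C)))) (+-monoʳ-≤ f grows))

  ReachableFrom : Fin k → (Fin k → Bool) → Set
  ReachableFrom p C = ∀ q → C q ≡ true → Walk R p q

  expand-reachable : ∀ C p → ReachableFrom p C → ReachableFrom p (expand C)
  expand-reachable C p s q e with C q in cq
  ... | true = s q cq
  ... | false with anyB-true _ e
  ... | p' , e' with C p' in cp' | R p' q in rp'q
  ... | true | true = snoc (s p' cp') rp'q
  expand-reachable C p s q e | false | p' , () | true | false
  expand-reachable C p s q e | false | p' , () | false | _

  saturate-reachable : ∀ f C p → ReachableFrom p C → ReachableFrom p (saturate f C)
  saturate-reachable zero C p s = s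
  saturate-reachable (suc f) C p s with isClosed C
  ... | true = s
  ... | false = saturate-reachable f (expand C) p (expand-reachable C p s)

  singleton-reachable : ∀ p → ReachableFrom p (_== p)
  singleton-reachable p q e with q F.≟ p
  ... | yes refl = here
  singleton-reachable p q () | no _

  component : Fin k → Fin k → Bool
  component p = saturate k (_== p)

  opaque
    disconnected⇒closed-split : ¬ Connected R →
      Σ (Fin k → Bool) λ X → (∃ λ p → X p ≡ true) × (∃ λ q → X q ≡ false) × Closed R X
    disconnected⇒closed-split nc with allB (λ p → allB (λ q → component p q)) in e
    ... | true = ⊥-elim (nc (λ x y → saturate-reachable k (_== x) x (singleton-reachable x) y
                                       (allB-true _ (allB-true _ e x) y)))
    ... | false with allB-false _ e
    ... | p , ep with allB-false _ ep
    ... | q , eq = component p , (p , saturate-⊇ k (_== p) p (==-refl p)) , (q , eq) ,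
                    saturate-closed k (_== p) (m≤m+n k _)

-- With s = |A| ≤ t = s + k = |B|,
-- σ = s + t ≤ m < 2δ, a lower bound σδ ≤ D on the degree sum and an upper bound
-- e ≤ st on the edges between A and B, the count c = D − 2e satisfies
--     2c ≥ k² + σ + rσ   where 2δ = σ + 1 + r,
-- which is at least 2δ; equality pins down every slack.

private
  odd≢even : ∀ s δ → s + s + 1 ≡ 2 * δ → ⊥
  odd≢even s δ e = even≢odd δ s (sym (trans (shape s) e))
    where
    shape : ∀ s → suc (2 * s) ≡ s + s + 1
    shape = solve-∀

  unit-slacks : ∀ a b k → 4 * b + suc k * suc k + 2 * a ≡ 1 → (a ≡ 0) × (b ≡ 0) × (suc k ≡ 1)
  unit-slacks a b k e = a0 , b0 , cong suc k0
    where
    shape : ∀ a b k → 4 * b + suc k * suc k + 2 * a ≡ suc (4 * b + (k + k * suc k) + 2 * a)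
    shape = solve-∀
    rest0 : 4 * b + (k + k * suc k) + 2 * a ≡ 0
    rest0 = suc-injective (trans (sym (shape a b k)) e)
    left0 : 4 * b + (k + k * suc k) ≡ 0
    left0 = m+n≡0⇒m≡0 (4 * b + (k + k * suc k)) rest0
    a0 : a ≡ 0
    a0 = m*n≡0⇒m≡0 a 2 (trans (*-comm a 2) (m+n≡0⇒n≡0 (4 * b + (k + k * suc k)) rest0))
    b0 : b ≡ 0
    b0 = m*n≡0⇒m≡0 b 4 (trans (*-comm b 4) (m+n≡0⇒m≡0 (4 * b) left0))
    k0 : k ≡ 0
    k0 = m+n≡0⇒m≡0 k (m+n≡0⇒n≡0 (4 * b) left0)

SlackConclusion : ℕ → ℕ → ℕ → ℕ → ℕ → ℕ → ℕ → ℕ → Set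
SlackConclusion σ k m δ c a b r =
  (δ ≤ c) × (c ≡ δ → 3 ≤ δ → (σ ≡ m) × (a ≡ 0) × (b ≡ 0) × (k ≡ 1) × (r ≡ 0))

-- Case r = 0, k ≥ 1: then 2c ≥ σ + 1 = 2δ, with equality only for unit slacks.
slack-r≡0 : ∀ s k m δ c a b → s + (s + suc k) ≤ m → suc m ≤ 2 * δ →
  s + (s + suc k) + 1 + 0 ≡ 2 * δ →
  2 * c ≡ 4 * b + suc k * suc k + (s + (s + suc k)) + 0 * (s + (s + suc k)) + 2 * a →
  SlackConclusion (s + (s + suc k)) (suc k) m δ c a b 0
slack-r≡0 s k m δ c a b σ≤m m<2δ er key = δ≤c , tight
  where
  σ = s + (s + suc k)
  rest = 4 * b + suc k * suc k + 2 * a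
  regroup : ∀ b kk σ a → 4 * b + kk + σ + 0 * σ + 2 * a ≡ (4 * b + kk + 2 * a) + σ
  regroup = solve-∀
  twice-c : 2 * c ≡ rest + σ
  twice-c = trans key (regroup b (suc k * suc k) σ a)
  rest≥1 : 1 ≤ rest
  rest≥1 = ≤-trans (s≤s z≤n) (≤-trans (m≤n+m (suc k * suc k) (4 * b)) (m≤m+n _ (2 * a)))
  δ≤c : δ ≤ c
  δ≤c = *-cancelˡ-≤ 2 (subst₂ _≤_ (trans (+-comm 1 σ) (trans (sym (+-identityʳ _)) er)) (sym twice-c)
          (+-monoˡ-≤ σ rest≥1))
  tight : c ≡ δ → 3 ≤ δ → (σ ≡ m) × (a ≡ 0) × (b ≡ 0) × (suc k ≡ 1) × (0 ≡ 0)
  tight refl _ = σ≡m , proj₁ units , proj₁ (proj₂ units) , proj₂ (proj₂ units) , refl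
    where
    rest≡1 : rest ≡ 1
    rest≡1 = +-cancelʳ-≡ σ _ _ (trans (sym twice-c) (trans (sym er) (trans (+-identityʳ _) (+-comm σ 1))))
    units = unit-slacks a b k rest≡1
    σ≡m : σ ≡ m
    σ≡m = ≤-antisym σ≤m (+-cancelʳ-≤ 1 m σ (subst₂ _≤_ (+-comm 1 m) (trans (sym er) (+-identityʳ _)) m<2δ))

-- Case r ≥ 1: σ ≥ 2 gives 2c ≥ σ + 1 + (r + 1) + r, so equality is impossible once δ ≥ 3.
slack-r≥1 : ∀ s k m δ c a b r → 1 ≤ s → s + (s + k) + 1 + suc r ≡ 2 * δ →
  2 * c ≡ 4 * b + k * k + (s + (s + k)) + suc r * (s + (s + k)) + 2 * a →
  SlackConclusion (s + (s + k)) k m δ c a b (suc r)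
slack-r≥1 s k m δ c a b r 1≤s er key = δ≤c , impossible
  where
  σ = s + (s + k)
  rest = 4 * b + k * k + 2 * a + r * σ
  σ≥2 : 2 ≤ σ
  σ≥2 = +-mono-≤ 1≤s (≤-trans 1≤s (m≤m+n s k))
  regroup : ∀ b kk σ r a → 4 * b + kk + σ + suc r * σ + 2 * a ≡ (4 * b + kk + 2 * a + r * σ) + (σ + σ)
  regroup = solve-∀
  twice-c : 2 * c ≡ rest + (σ + σ)
  twice-c = trans key (regroup b (k * k) σ r a)
  lower : (σ + 1 + suc r) + r ≤ 2 * c
  lower = ≤-trans (≤-reflexive (sym (shape σ r)))
            (≤-trans (+-mono-≤ (≤-trans (≤-reflexive (*-comm 2 r))
                                  (≤-trans (*-monoʳ-≤ r σ≥2) (m≤n+m (r * σ) (4 * b + k * k + 2 * a))))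
                               (+-monoʳ-≤ σ σ≥2))
              (≤-reflexive (sym twice-c)))
    where
    shape : ∀ σ r → 2 * r + (σ + 2) ≡ σ + 1 + suc r + r
    shape = solve-∀
  δ≤c : δ ≤ c
  δ≤c = *-cancelˡ-≤ 2 (subst (_≤ 2 * c) er (≤-trans (m≤m+n _ r) lower))
  impossible : c ≡ δ → 3 ≤ δ → _
  impossible refl δ≥3 = ⊥-elim (<⇒≱ δ≥3 (*-cancelˡ-≤ 2 2δ≤4))
    where
    shape : ∀ σ → σ + 1 + 1 ≡ σ + 2
    shape = solve-∀
    r≡0 : r ≡ 0
    r≡0 = n≤0⇒n≡0 (+-cancelˡ-≤ (σ + 1 + suc r) r 0
            (≤-trans lower (≤-reflexive (trans (sym er) (sym (+-identityʳ _))))))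
    σ≤2 : σ ≤ 2
    σ≤2 = +-cancelˡ-≤ σ σ 2
            (subst (σ + σ ≤_) (trans (sym er) (trans (cong (λ z → σ + 1 + suc z) r≡0) (shape σ)))
              (≤-trans (m≤n+m (σ + σ) rest) (≤-reflexive (sym twice-c))))
    2δ≤4 : 2 * δ ≤ 2 * 2
    2δ≤4 = subst (_≤ 4) er (subst (λ z → σ + 1 + suc z ≤ 4) (sym r≡0)
             (≤-trans (≤-reflexive (shape σ)) (+-monoˡ-≤ 2 σ≤2)))

slack-analysis : ∀ s k m δ c a b r → 1 ≤ s → s + (s + k) ≤ m → suc m ≤ 2 * δ →
  s + (s + k) + 1 + r ≡ 2 * δ →
  2 * c ≡ 4 * b + k * k + (s + (s + k)) + r * (s + (s + k)) + 2 * a →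
  SlackConclusion (s + (s + k)) k m δ c a b r
slack-analysis s zero m δ c a b zero 1≤s σ≤m m<2δ er key =
  ⊥-elim (odd≢even s δ (trans (cong (λ z → s + z + 1) (sym (+-identityʳ s))) (trans (sym (+-identityʳ _)) er)))
slack-analysis s (suc k) m δ c a b zero 1≤s σ≤m m<2δ er key = slack-r≡0 s k m δ c a b σ≤m m<2δ er key
slack-analysis s k m δ c a b (suc r) 1≤s σ≤m m<2δ er key = slack-r≥1 s k m δ c a b r 1≤s er key

-- In terms of the slacks D = σδ + a, st = e + b and 2δ = σ + 1 + r, completing the
-- square (s + t)² = 4st + k² gives 2c = 4b + k² + σ + rσ + 2a.
twice-crossing : ∀ s k δ c e D a b r → c + 2 * e ≡ D →
  (s + (s + k)) * δ + a ≡ D → e + b ≡ s * (s + k) → s + (s + k) + 1 + r ≡ 2 * δ →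
  2 * c ≡ 4 * b + k * k + (s + (s + k)) + r * (s + (s + k)) + 2 * a
twice-crossing s k δ c e D a b r c+2e≡D ea eb er =
  +-cancelʳ-≡ (4 * e) (2 * c) X (trans (sym (twice c e)) (trans (cong (2 *_) c+2e≡D) (sym X+4e≡2D)))
  where
  σ = s + (s + k)
  X = 4 * b + k * k + σ + r * σ + 2 * a
  regroup : ∀ e b kk σ r a → 4 * b + kk + σ + r * σ + 2 * a + 4 * e ≡ 4 * (e + b) + kk + σ + r * σ + 2 * a
  regroup = solve-∀
  complete-square : ∀ s k r a → 4 * (s * (s + k)) + k * k + (s + (s + k)) + r * (s + (s + k)) + 2 * a
                                ≡ (s + (s + k)) * (s + (s + k) + 1 + r) + 2 * a
  complete-square = solve-∀
  double : ∀ σ δ a → σ * (2 * δ) + 2 * a ≡ 2 * (σ * δ + a)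
  double = solve-∀
  twice : ∀ c e → 2 * (c + 2 * e) ≡ 2 * c + 4 * e
  twice = solve-∀
  X+4e≡2D : X + 4 * e ≡ 2 * D
  X+4e≡2D = begin
    X + 4 * e ≡⟨ regroup e b (k * k) σ r a ⟩
    4 * (e + b) + k * k + σ + r * σ + 2 * a ≡⟨ cong (λ z → 4 * z + k * k + σ + r * σ + 2 * a) eb ⟩
    4 * (s * (s + k)) + k * k + σ + r * σ + 2 * a ≡⟨ complete-square s k r a ⟩
    σ * (σ + 1 + r) + 2 * a ≡⟨ cong (λ z → σ * z + 2 * a) er ⟩
    σ * (2 * δ) + 2 * a ≡⟨ double σ δ a ⟩
    2 * (σ * δ + a) ≡⟨ cong (2 *_) ea ⟩
    2 * D ∎
    where open ≡-Reasoning

crossing-arithmetic : ∀ s k m δ c e D →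
  1 ≤ s → s + (s + k) ≤ m → suc m ≤ 2 * δ → c + 2 * e ≡ D →
  (s + (s + k)) * δ ≤ D → e ≤ s * (s + k) →
  (δ ≤ c) × (c ≡ δ → 3 ≤ δ →
     (s + (s + k) ≡ m) × (D ≡ (s + (s + k)) * δ) × (e ≡ s * (s + k)) × (k ≡ 1) × (s + (s + k) + 1 ≡ 2 * δ))
crossing-arithmetic s k m δ c e D 1≤s σ≤m m<2δ c+2e≡D σδ≤D e≤st =
  proj₁ analysis , λ c≡δ δ≥3 → unslack (proj₂ analysis c≡δ δ≥3)
  where
  σ = s + (s + k)
  σ+1≤2δ : σ + 1 ≤ 2 * δ
  σ+1≤2δ = ≤-trans (+-monoˡ-≤ 1 σ≤m) (subst (_≤ 2 * δ) (+-comm 1 m) m<2δ)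
  a = proj₁ (m≤n⇒∃[o]m+o≡n σδ≤D)
  b = proj₁ (m≤n⇒∃[o]m+o≡n e≤st)
  r = proj₁ (m≤n⇒∃[o]m+o≡n σ+1≤2δ)
  ea : σ * δ + a ≡ D
  ea = proj₂ (m≤n⇒∃[o]m+o≡n σδ≤D)
  eb : e + b ≡ s * (s + k)
  eb = proj₂ (m≤n⇒∃[o]m+o≡n e≤st)
  er : σ + 1 + r ≡ 2 * δ
  er = proj₂ (m≤n⇒∃[o]m+o≡n σ+1≤2δ)
  analysis = slack-analysis s k m δ c a b r 1≤s σ≤m m<2δ er (twice-crossing s k δ c e D a b r c+2e≡D ea eb er)
  unslack : (σ ≡ m) × (a ≡ 0) × (b ≡ 0) × (k ≡ 1) × (r ≡ 0) →
     (σ ≡ m) × (D ≡ σ * δ) × (e ≡ s * (s + k)) × (k ≡ 1) × (σ + 1 ≡ 2 * δ)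
  unslack (σ≡m , a≡0 , b≡0 , k≡1 , r≡0) = σ≡m ,
    trans (sym ea) (trans (cong (σ * δ +_) a≡0) (+-identityʳ _)) ,
    trans (sym (+-identityʳ e)) (trans (cong (e +_) (sym b≡0)) eb) , k≡1 ,
    trans (sym (+-identityʳ _)) (trans (cong (σ + 1 +_) (sym r≡0)) er)

-- For A, B ⊆ V(H) (boolean predicates):
--   cross A B   = #{ordered edges uv : u ∈ A xor v ∈ B},
--   between A B = #{ordered edges uv : u ∈ A and v ∈ B},
--   degSum A    = Σ_{u ∈ A} deg u.
-- cross X_x X_y is exactly the contribution of a G-edge xy to the boundary of X in
-- G × H.

Mixed : ∀ {m} → (Fin m → Bool) → Set
Mixed A = (∃ λ u → A u ≡ true) × (∃ λ v → A v ≡ false)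

Mixed-∁ : ∀ {m} (A : Fin m → Bool) → Mixed A → Mixed (∁ A)
Mixed-∁ A ((u , eu) , (v , ev)) = (v , cong not ev) , (u , cong not eu)

Mixed-∁⁻¹ : ∀ {m} (A : Fin m → Bool) → Mixed (∁ A) → Mixed A
Mixed-∁⁻¹ A ((u , eu) , (v , ev)) = (v , not-false ev) , (u , not-true eu)

IsEmpty : ∀ {m} → (Fin m → Bool) → Set
IsEmpty B = ∀ u → B u ≡ false

IsFull : ∀ {m} → (Fin m → Bool) → Set
IsFull B = ∀ u → B u ≡ true

∁-full : ∀ {m} (B : Fin m → Bool) → IsFull B → IsEmpty (∁ B)
∁-full B h u rewrite h u = refl

data Shape {m} (B : Fin m → Bool) : Set where
  empty : IsEmpty B → Shape B
  full  : IsFull B → Shape B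
  mixed : Mixed B → Shape B

classify : ∀ {m} (B : Fin m → Bool) → Shape B
classify B with bool-cases (anyB B) | bool-cases (anyB (∁ B))
... | inj₂ none | _ = empty (anyB-false B none)
... | inj₁ some | inj₂ none = full (λ u → trans (sym (BP.not-involutive (B u))) (cong not (anyB-false (∁ B) none u)))
... | inj₁ some | inj₁ some' =
  mixed (anyB-true B some , (proj₁ (anyB-true (∁ B) some') , not-true (proj₂ (anyB-true (∁ B) some'))))

Mixed? : ∀ {m} (B : Fin m → Bool) → Dec (Mixed B)
Mixed? B with classify B
... | empty h = no (λ mB → true≢false (trans (sym (proj₂ (proj₁ mB))) (h _)))
... | full h = no (λ mB → true≢false (trans (sym (h _)) (proj₂ (proj₂ mB))))
... | mixed h = yes h

-- H has the shape of K̄_{2l-1} ∨ lK₂: an independent set P, completely joined to its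
-- complement, whose complement is a perfect matching one vertex larger than P.
JoinStructure : ∀ {m} → Graph m → Set
JoinStructure {m} H = Σ (Fin m → Bool) λ P →
  (∀ u v → P u ≡ true → P v ≡ true → adj H u v ≡ false) ×
  (∀ u v → P u ≡ true → P v ≡ false → adj H u v ≡ true) ×
  (∀ v → P v ≡ false → ∑ (λ w → b2n (adj H v w ∧ not (P w))) ≡ 1) ×
  (count P + 1 ≡ count (∁ P))

module CrossingCounts {m : ℕ} (H : Graph m) where

  deg∑ : Fin m → ℕ
  deg∑ u = ∑ (λ v → b2n (adj H u v))

  cross : (Fin m → Bool) → (Fin m → Bool) → ℕ
  cross A B = ∑ (λ u → ∑ (λ v → b2n (adj H u v ∧ (A u xor B v))))

  between : (Fin m → Bool) → (Fin m → Bool) → ℕ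
  between A B = ∑ (λ u → ∑ (λ v → b2n (adj H u v ∧ (A u ∧ B v))))

  degSum : (Fin m → Bool) → ℕ
  degSum A = ∑ (λ u → b2n (A u) * deg∑ u)

  rowSum : ∀ A → ∑ (λ u → ∑ (λ v → b2n (adj H u v ∧ A u))) ≡ degSum A
  rowSum A = ∑-cong (λ u → trans (∑-cong (λ v → flip (adj H u v) (A u))) (∑-*ˡ (b2n (A u)) _))
    where
    flip : ∀ a p → b2n (a ∧ p) ≡ b2n p * b2n a
    flip a p = trans (b2n-∧ a p) (*-comm (b2n a) (b2n p))

  colSum : ∀ B → ∑ (λ u → ∑ (λ v → b2n (adj H u v ∧ B v))) ≡ degSum B
  colSum B = trans (∑-swap _)
    (trans (∑-cong (λ v → ∑-cong (λ u → cong (λ z → b2n (z ∧ B v)) (adj-sym H u v)))) (rowSum B))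

  -- Each edge leaving A is counted once by degSum A; each edge from A into B is
  -- counted by both degree sums.
  cross-identity : ∀ A B → cross A B + 2 * between A B ≡ degSum A + degSum B
  cross-identity A B = begin
      cross A B + 2 * between A B ≡⟨ cong (cross A B +_) (sym (trans (∑-cong (λ u → ∑-*ˡ 2 _)) (∑-*ˡ 2 _))) ⟩
      cross A B + ∑ (λ u → ∑ (λ v → 2 * b2n (adj H u v ∧ (A u ∧ B v)))) ≡⟨ sym (∑-+ _ _) ⟩
      ∑ (λ u → ∑ (λ v → b2n (adj H u v ∧ (A u xor B v))) + ∑ (λ v → 2 * b2n (adj H u v ∧ (A u ∧ B v))))
        ≡⟨ ∑-cong (λ u → trans (sym (∑-+ _ _))
             (trans (∑-cong (λ v → pointwise (adj H u v) (A u) (B v))) (∑-+ _ _))) ⟩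
      ∑ (λ u → ∑ (λ v → b2n (adj H u v ∧ A u)) + ∑ (λ v → b2n (adj H u v ∧ B v))) ≡⟨ ∑-+ _ _ ⟩
      _ ≡⟨ cong₂ _+_ (rowSum A) (colSum B) ⟩
      degSum A + degSum B ∎
    where
    open ≡-Reasoning
    pointwise : ∀ a p q → b2n (a ∧ (p xor q)) + 2 * b2n (a ∧ (p ∧ q)) ≡ b2n (a ∧ p) + b2n (a ∧ q)
    pointwise true true true = refl
    pointwise true true false = refl
    pointwise true false true = refl
    pointwise true false false = refl
    pointwise false p q = refl

  cross-∁ : ∀ A B → cross (∁ A) (∁ B) ≡ cross A B
  cross-∁ A B = ∑-cong (λ u → ∑-cong (λ v → cong (λ z → b2n (adj H u v ∧ z)) (xor-not (A u) (B v))))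

  cross-sym : ∀ A B → cross B A ≡ cross A B
  cross-sym A B = trans (∑-swap _) (∑-cong (λ u → ∑-cong (λ v →
    cong₂ (λ a z → b2n (a ∧ z)) (adj-sym H v u) (BP.xor-comm (B v) (A u)))))

  degSum≥ : ∀ δ → (∀ u → δ ≤ deg∑ u) → ∀ A → count A * δ ≤ degSum A
  degSum≥ δ δ≤deg A = subst (_≤ degSum A) (∑-*ʳ δ _) (∑-mono (λ u → *-monoʳ-≤ (b2n (A u)) (δ≤deg u)))

  b2n-∧-≤ : ∀ a p q → b2n (a ∧ (p ∧ q)) ≤ b2n p * b2n q
  b2n-∧-≤ true true true = s≤s z≤n
  b2n-∧-≤ true true false = z≤n
  b2n-∧-≤ true false q = z≤n
  b2n-∧-≤ false true true = z≤n
  b2n-∧-≤ false true false = z≤n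
  b2n-∧-≤ false false q = z≤n

  between≤ : ∀ A B → between A B ≤ count A * count B
  between≤ A B = ≤-trans (∑-mono (λ u → ≤-trans (∑-mono (λ v → b2n-∧-≤ (adj H u v) (A u) (B v)))
                        (≤-reflexive (∑-*ˡ (b2n (A u)) _))))
                     (≤-reflexive (∑-*ʳ (count B) _))

  cross-empty : ∀ A B → IsEmpty B → cross A B ≡ degSum A
  cross-empty A B h = begin
      cross A B ≡⟨ sym (+-identityʳ _) ⟩
      cross A B + 2 * 0 ≡⟨ cong (λ z → cross A B + 2 * z) (sym between≡0) ⟩
      cross A B + 2 * between A B ≡⟨ cross-identity A B ⟩
      degSum A + degSum B ≡⟨ cong (degSum A +_) degSum≡0 ⟩
      degSum A + 0 ≡⟨ +-identityʳ _ ⟩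
      degSum A ∎
    where
    open ≡-Reasoning
    count≡0 : count B ≡ 0
    count≡0 = trans (∑-cong (λ u → cong b2n (h u))) (∑-zeros {m})
    degSum≡0 : degSum B ≡ 0
    degSum≡0 = trans (∑-cong (λ u → cong (λ z → b2n z * deg∑ u) (h u))) (∑-zeros {m})
    between≡0 : between A B ≡ 0
    between≡0 = n≤0⇒n≡0 (≤-trans (between≤ A B)
                  (≤-reflexive (trans (cong (count A *_) count≡0) (*-zeroʳ (count A)))))

  deg∑-split : ∀ (P : Fin m → Bool) u →
    deg∑ u ≡ ∑ (λ w → b2n (adj H u w ∧ P w)) + ∑ (λ w → b2n (adj H u w ∧ not (P w)))
  deg∑-split P u = trans (∑-cong (λ w → pointwise (adj H u w) (P w))) (∑-+ _ _)
    where
    pointwise : ∀ a p → b2n a ≡ b2n (a ∧ p) + b2n (a ∧ not p)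
    pointwise true true = refl
    pointwise true false = refl
    pointwise false p = refl

  joinStructure-from-regular : ∀ δ (P : Fin m → Bool) →
    (∀ u v → P u ≡ true → P v ≡ false → adj H u v ≡ true) →
    (∀ u → deg∑ u ≡ δ) → count (∁ P) ≡ δ → count P + 1 ≡ count (∁ P) → JoinStructure H
  joinStructure-from-regular δ P joined regular |∁P| |P|+1 = P , independent , joined , matching , |P|+1
    where
    joined' : ∀ u v → P u ≡ false → P v ≡ true → adj H u v ≡ true
    joined' u v pu pv = trans (adj-sym H u v) (joined v u pv pu)
    -- all δ neighbours of u ∈ P lie outside P
    independent : ∀ u v → P u ≡ true → P v ≡ true → adj H u v ≡ false
    independent u v pu pv with ∑≡0⇒pointwise _ inside≡0 v
      where
      outside : ∑ (λ w → b2n (adj H u w ∧ not (P w))) ≡ δ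
      outside = trans (∑-cong pointwise) |∁P|
        where
        pointwise : ∀ w → b2n (adj H u w ∧ not (P w)) ≡ b2n (not (P w))
        pointwise w with P w in ew
        ... | true = cong b2n (BP.∧-zeroʳ (adj H u w))
        ... | false rewrite joined u w pu ew = refl
      inside≡0 : ∑ (λ w → b2n (adj H u w ∧ P w)) ≡ 0
      inside≡0 = +-cancelʳ-≡ δ _ 0 (trans (cong (_ +_) (sym outside)) (trans (sym (deg∑-split P u)) (regular u)))
    ... | z with adj H u v
    ... | false = refl
    ... | true rewrite pv = ⊥-elim (1+n≢0 z)
    -- v ∉ P sees all of P, so exactly one of its δ = |P| + 1 neighbours lies outside P
    matching : ∀ v → P v ≡ false → ∑ (λ w → b2n (adj H v w ∧ not (P w))) ≡ 1
    matching v pv = +-cancelˡ-≡ (count P) _ 1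
      (trans (cong (_+ ∑ (λ w → b2n (adj H v w ∧ not (P w)))) (sym inside))
        (trans (sym (deg∑-split P v)) (trans (regular v) (trans (sym |∁P|) (sym |P|+1)))))
      where
      inside : ∑ (λ w → b2n (adj H v w ∧ P w)) ≡ count P
      inside = ∑-cong pointwise
        where
        pointwise : ∀ w → b2n (adj H v w ∧ P w) ≡ b2n (P w)
        pointwise w with P w in ew
        ... | true rewrite joined' v w pv ew = refl
        ... | false = cong b2n (BP.∧-zeroʳ (adj H v w))

  deg∑+1 : ∀ u → ∑ (λ w → b2n (adj H u w) + b2n (w == u)) ≡ deg∑ u + 1
  deg∑+1 u = trans (∑-+ _ _) (cong (deg∑ u +_) (count-singleton u))

  neighbour-or-self : ∀ u w → b2n (adj H u w) + b2n (w == u) ≤ 1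
  neighbour-or-self u w with w F.≟ u
  ... | yes refl rewrite adj-irr H u = s≤s z≤n
  ... | no _ = ≤-trans (≤-reflexive (+-identityʳ _)) (b2n≤1 (adj H u w))

  deg∑<m : ∀ u → deg∑ u + 1 ≤ m
  deg∑<m u = subst₂ _≤_ (deg∑+1 u) (trans (∑-const {m} 1) (*-identityʳ m)) (∑-mono (neighbour-or-self u))

  deg∑-missing : ∀ u v → ¬ v ≡ u → adj H u v ≡ false → deg∑ u + 1 < m
  deg∑-missing u v ne e = subst₂ _<_ (deg∑+1 u) (trans (∑-const {m} 1) (*-identityʳ m))
    (∑-mono-strict _ _ (neighbour-or-self u) v
      (subst (_< 1) (sym (cong₂ (λ a b → b2n a + b2n b) e (==-no v u ne))) (s≤s z≤n)))

  between-full⇒complete : ∀ (A B : Fin m → Bool) → between A B ≡ count A * count B →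
    ∀ u v → A u ≡ true → B v ≡ true → adj H u v ≡ true
  between-full⇒complete A B e u v au bv =
    edge (∑-tight _ _ (λ w → b2n-∧-≤ (adj H u w) (A u) (B w)) (≤-reflexive (sym row)) v)
    where
    products : ∑ (λ u → ∑ (λ v → b2n (A u) * b2n (B v))) ≡ count A * count B
    products = trans (∑-cong (λ u → ∑-*ˡ (b2n (A u)) _)) (∑-*ʳ (count B) _)
    row : ∑ (λ w → b2n (adj H u w ∧ (A u ∧ B w))) ≡ ∑ (λ w → b2n (A u) * b2n (B w))
    row = ∑-tight _ _ (λ u → ∑-mono (λ w → b2n-∧-≤ (adj H u w) (A u) (B w)))
            (≤-reflexive (trans products (sym e))) u
    edge : b2n (adj H u v ∧ (A u ∧ B v)) ≡ b2n (A u) * b2n (B v) → adj H u v ≡ true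
    edge eq with adj H u v
    ... | true = refl
    ... | false rewrite au | bv = ⊥-elim (0≢1+n eq)

  complete-between⇒complement : ∀ (A B : Fin m → Bool) → between A B ≡ count A * count B →
    count A + count B ≡ m → ∀ u → B u ≡ not (A u)
  complete-between⇒complement A B e sizes u = decide (∑-tight _ _ at-most-one tight u)
    where
    disjoint : ∀ u → A u ≡ true → B u ≡ true → ⊥
    disjoint u au bu = true≢false (trans (sym (between-full⇒complete A B e u u au bu)) (adj-irr H u))
    at-most-one : ∀ u → b2n (A u) + b2n (B u) ≤ 1
    at-most-one u with A u in au | B u in bu
    ... | true | true = ⊥-elim (disjoint u au bu)
    ... | true | false = s≤s z≤n
    ... | false | _ = b2n≤1 _
    tight : ∑ (λ _ → 1) ≤ ∑ (λ u → b2n (A u) + b2n (B u))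
    tight = ≤-reflexive (trans (trans (∑-const {m} 1) (*-identityʳ m)) (trans (sym sizes) (sym (∑-+ _ _))))
    decide : b2n (A u) + b2n (B u) ≡ 1 → B u ≡ not (A u)
    decide one with A u in au | B u in bu
    ... | true | true = ⊥-elim (disjoint u au bu)
    ... | true | false = refl
    ... | false | true = refl
    ... | false | false = ⊥-elim (0≢1+n one)

  module AboveHalf (δ : ℕ) (δ≤deg : ∀ u → δ ≤ deg∑ u) (m<2δ : suc m ≤ 2 * δ) (3≤m : 3 ≤ m) where

    δ≥2 : 2 ≤ δ
    δ≥2 = *-cancelˡ-≤ 2 (≤-trans (s≤s 3≤m) m<2δ)

    δ≥1 : 1 ≤ δ
    δ≥1 = ≤-trans (s≤s z≤n) δ≥2

    ≤-*δ : ∀ c → 1 ≤ c → δ ≤ c * δ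
    ≤-*δ (suc c) _ = m≤m+n δ (c * δ)

    *δ≤δ⇒≤1 : ∀ d → d * δ ≤ δ → d ≤ 1
    *δ≤δ⇒≤1 zero _ = z≤n
    *δ≤δ⇒≤1 (suc zero) _ = s≤s z≤n
    *δ≤δ⇒≤1 (suc (suc d)) le = ⊥-elim (<⇒≱ δ≥1 (+-cancelˡ-≤ δ δ 0
      (≤-trans (+-monoʳ-≤ δ (m≤m+n δ (d * δ))) (≤-trans le (≤-reflexive (sym (+-identityʳ δ)))))))

    cross-vs-empty : ∀ A B → Mixed A → IsEmpty B → δ ≤ cross A B × (cross A B ≡ δ → count A ≡ 1)
    cross-vs-empty A B ((u , eu) , _) hB = lower , tight
      where
      |A|≥1 = count-pos A u eu
      lower = ≤-trans (≤-*δ (count A) |A|≥1) (≤-trans (degSum≥ δ δ≤deg A) (≤-reflexive (sym (cross-empty A B hB))))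
      tight : cross A B ≡ δ → count A ≡ 1
      tight e = ≤-antisym (*δ≤δ⇒≤1 (count A)
                  (≤-trans (degSum≥ δ δ≤deg A) (≤-reflexive (trans (sym (cross-empty A B hB)) e)))) |A|≥1

    cross-vs-full : ∀ A B → Mixed A → IsFull B → δ ≤ cross A B × (cross A B ≡ δ → count (∁ A) ≡ 1)
    cross-vs-full A B mA hB with cross-vs-empty (∁ A) (∁ B) (Mixed-∁ A mA) (∁-full B hB)
    ... | lower , tight = subst (δ ≤_) (cross-∁ A B) lower , λ e → tight (trans (cross-∁ A B) e)

    complete-if-dense : m ≤ δ + 1 → ∀ u v → ¬ v ≡ u → adj H u v ≡ true
    complete-if-dense le u v ne with adj H u v in e
    ... | true = refl
    ... | false = ⊥-elim (<⇒≱ (deg∑-missing u v ne e) (≤-trans le (+-monoˡ-≤ 1 (δ≤deg u))))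

    -- For δ = 2 the graph is K₃ = K̄₁ ∨ K₂.
    joinStructure-K₃ : δ ≤ 2 → Fin m → JoinStructure H
    joinStructure-K₃ δ≤2 u₀ = joinStructure-from-regular 2 P joined regular |∁P| |P|+1
      where
      δ≡2 : δ ≡ 2
      δ≡2 = ≤-antisym δ≤2 δ≥2
      m≡3 : m ≡ 3
      m≡3 = ≤-antisym (+-cancelʳ-≤ 1 m 3 (≤-trans (subst (_≤ 2 * δ) (+-comm 1 m) m<2δ)
                        (≤-reflexive (cong (2 *_) δ≡2)))) 3≤m
      P : Fin m → Bool
      P w = w == u₀
      joined : ∀ u v → P u ≡ true → P v ≡ false → adj H u v ≡ true
      joined u v pu pv = complete-if-dense (≤-reflexive (trans m≡3 (cong (_+ 1) (sym δ≡2)))) u v ne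
        where
        ne : ¬ v ≡ u
        ne refl = true≢false (trans (sym pu) pv)
      regular : ∀ u → deg∑ u ≡ 2
      regular u = ≤-antisym (+-cancelʳ-≤ 1 (deg∑ u) 2 (≤-trans (deg∑<m u) (≤-reflexive m≡3)))
                    (subst (_≤ deg∑ u) δ≡2 (δ≤deg u))
      |∁P| : count (∁ P) ≡ 2
      |∁P| = +-cancelˡ-≡ 1 _ 2 (trans (cong (_+ count (∁ P)) (sym (count-singleton u₀))) (trans (count-∁ P) m≡3))
      |P|+1 : count P + 1 ≡ count (∁ P)
      |P|+1 = trans (cong (_+ 1) (count-singleton u₀)) (sym |∁P|)

    split-tight : ∀ a b x y → x ≤ a → y ≤ b → a + b ≡ x + y → a ≡ x
    split-tight a b x y xa yb e = ≤-antisym (+-cancelʳ-≤ b a x (≤-trans (≤-reflexive e) (+-monoʳ-≤ x yb))) xa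

    degSum-tight⇒regular : ∀ (A : Fin m → Bool) → degSum A ≡ count A * δ → ∀ u → A u ≡ true → deg∑ u ≡ δ
    degSum-tight⇒regular A e u au with ∑-tight (λ w → b2n (A w) * δ) (λ w → b2n (A w) * deg∑ w)
                        (λ w → *-monoʳ-≤ (b2n (A w)) (δ≤deg w))
                        (≤-reflexive (trans e (sym (∑-*ʳ δ _)))) u
    ... | r rewrite au = sym (trans (sym (+-identityʳ δ)) (trans r (+-identityʳ _)))

    -- The extremal configuration of the arithmetic: |A| = s, B = ∁ A with |B| = s + 1 = δ,
    -- H δ-regular and A completely joined to B.  This is the join structure.
    tight⇒joinStructure : ∀ (A B : Fin m → Bool) →
      between A B ≡ count A * count B → count A + count B ≡ m →
      degSum A + degSum B ≡ (count A + count B) * δ → count A + 1 ≡ count B →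
      count A + count B + 1 ≡ 2 * δ → JoinStructure H
    tight⇒joinStructure A B complete sizes degrees |B| parity =
      joinStructure-from-regular δ A joined regular |∁A|≡δ (trans |B| (sym |∁A|≡|B|))
      where
      s = count A
      t = count B
      B≡∁A = complete-between⇒complement A B complete sizes
      degrees' : degSum A + degSum B ≡ s * δ + t * δ
      degrees' = trans degrees (*-distribʳ-+ δ s t)
      degSum-A : degSum A ≡ s * δ
      degSum-A = split-tight (degSum A) (degSum B) (s * δ) (t * δ) (degSum≥ δ δ≤deg A) (degSum≥ δ δ≤deg B) degrees'
      degSum-B : degSum B ≡ t * δ
      degSum-B = split-tight (degSum B) (degSum A) (t * δ) (s * δ) (degSum≥ δ δ≤deg B) (degSum≥ δ δ≤deg A)
                   (trans (+-comm (degSum B) (degSum A)) (trans degrees' (+-comm (s * δ) (t * δ))))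
      regular : ∀ u → deg∑ u ≡ δ
      regular u with A u in au
      ... | true = degSum-tight⇒regular A degSum-A u au
      ... | false = degSum-tight⇒regular B degSum-B u (trans (B≡∁A u) (cong not au))
      joined : ∀ u v → A u ≡ true → A v ≡ false → adj H u v ≡ true
      joined u v au av = between-full⇒complete A B complete u v au (trans (B≡∁A v) (cong not av))
      |∁A|≡|B| : count (∁ A) ≡ t
      |∁A|≡|B| = ∑-cong (λ u → cong b2n (sym (B≡∁A u)))
      t≡δ : t ≡ δ
      t≡δ = *-cancelˡ-≡ t δ 2 (trans (shape-2t s t (sym |B|)) parity)
        where
        shape-2t : ∀ s t → t ≡ s + 1 → 2 * t ≡ s + t + 1
        shape-2t s t refl = solve s
          where
          solve : ∀ s → 2 * (s + 1) ≡ s + (s + 1) + 1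
          solve = solve-∀
      |∁A|≡δ : count (∁ A) ≡ δ
      |∁A|≡δ = trans |∁A|≡|B| t≡δ

    cross-vs-mixed-ordered : ∀ (A B : Fin m → Bool) → Mixed A → Mixed B →
      count A ≤ count B → count A + count B ≤ m →
      δ ≤ cross A B × (cross A B ≡ δ → 3 ≤ δ → JoinStructure H)
    cross-vs-mixed-ordered A B mA mB s≤t σ≤m with m≤n⇒∃[o]m+o≡n s≤t
    ... | k , s+k≡t = proj₁ bound , λ e δ≥3 → extremal (proj₂ bound e δ≥3)
      where
      s = count A
      σ≤m' : s + (s + k) ≤ m
      σ≤m' = subst (λ z → s + z ≤ m) (sym s+k≡t) σ≤m
      degrees : (s + (s + k)) * δ ≤ degSum A + degSum B
      degrees = subst (λ z → (s + z) * δ ≤ degSum A + degSum B) (sym s+k≡t)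
             (subst (_≤ degSum A + degSum B) (sym (*-distribʳ-+ δ s (count B)))
               (+-mono-≤ (degSum≥ δ δ≤deg A) (degSum≥ δ δ≤deg B)))
      edges : between A B ≤ s * (s + k)
      edges = subst (λ z → between A B ≤ s * z) (sym s+k≡t) (between≤ A B)
      bound = crossing-arithmetic s k m δ (cross A B) (between A B) (degSum A + degSum B)
                (count-pos A (proj₁ (proj₁ mA)) (proj₂ (proj₁ mA))) σ≤m' m<2δ (cross-identity A B) degrees edges
      extremal : (s + (s + k) ≡ m) × (degSum A + degSum B ≡ (s + (s + k)) * δ) × (between A B ≡ s * (s + k)) ×
                 (k ≡ 1) × (s + (s + k) + 1 ≡ 2 * δ) → JoinStructure H
      extremal (σ≡m , degs , betw , k≡1 , parity) rewrite s+k≡t =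
        tight⇒joinStructure A B betw σ≡m degs (trans (cong (s +_) (sym k≡1)) s+k≡t) parity

    cross-vs-mixed-small : ∀ (A B : Fin m → Bool) → Mixed A → Mixed B → count A + count B ≤ m →
      δ ≤ cross A B × (cross A B ≡ δ → 3 ≤ δ → JoinStructure H)
    cross-vs-mixed-small A B mA mB σ≤m with count A ≤? count B
    ... | yes s≤t = cross-vs-mixed-ordered A B mA mB s≤t σ≤m
    ... | no s≰t = subst (δ ≤_) (cross-sym A B) (proj₁ swapped) , λ e → proj₂ swapped (trans (cross-sym A B) e)
      where
      swapped = cross-vs-mixed-ordered B A mB mA (≰⇒≥ s≰t) (subst (_≤ m) (+-comm (count A) (count B)) σ≤m)

    -- Both sets mixed: remove |A| + |B| ≤ m by passing to complements, and handle δ = 2.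
    cross-vs-mixed : ∀ (A B : Fin m → Bool) → Mixed A → Mixed B →
      δ ≤ cross A B × (cross A B ≡ δ → JoinStructure H)
    cross-vs-mixed A B mA mB = proj₁ bound , λ e → small-δ (proj₂ bound e)
      where
      bound : δ ≤ cross A B × (cross A B ≡ δ → 3 ≤ δ → JoinStructure H)
      bound with count A + count B ≤? m
      ... | yes σ≤m = cross-vs-mixed-small A B mA mB σ≤m
      ... | no σ≰m = subst (δ ≤_) (cross-∁ A B) (proj₁ complements) , λ e → proj₂ complements (trans (cross-∁ A B) e)
        where
        regroup : ∀ a b c d → a + b + (c + d) ≡ c + a + (d + b)
        regroup = solve-∀
        total : count (∁ A) + count (∁ B) + (count A + count B) ≡ m + m
        total = trans (regroup (count (∁ A)) (count (∁ B)) (count A) (count B)) (cong₂ _+_ (count-∁ A) (count-∁ B))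
        σ'≤m : count (∁ A) + count (∁ B) ≤ m
        σ'≤m = +-cancelʳ-≤ (count A + count B) _ m (≤-trans (≤-reflexive total) (+-monoʳ-≤ m (≰⇒≥ σ≰m)))
        complements = cross-vs-mixed-small (∁ A) (∁ B) (Mixed-∁ A mA) (Mixed-∁ B mB) σ'≤m
      small-δ : (3 ≤ δ → JoinStructure H) → JoinStructure H
      small-δ f with 3 ≤? δ
      ... | yes δ≥3 = f δ≥3
      ... | no δ≱3 = joinStructure-K₃ (≤-pred (≰⇒> δ≱3)) (proj₁ (proj₁ mA))

    cross≥δ : ∀ A B → Mixed A → δ ≤ cross A B
    cross≥δ A B mA with classify B
    ... | empty h = proj₁ (cross-vs-empty A B mA h)
    ... | full h = proj₁ (cross-vs-full A B mA h)
    ... | mixed h = proj₁ (cross-vs-mixed A B mA h)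

injective⇒surjective : ∀ {a b} → a ≡ b → (f : Fin a → Fin b) → (∀ x y → f x ≡ f y → x ≡ y) →
  ∀ j → ∃ λ i → f i ≡ j
injective⇒surjective {a} {suc b'} refl f inj j with FP.any? (λ i → f i F.≟ j)
... | yes hit = hit
... | no miss = ⊥-elim (<-irrefl refl (FP.injective⇒≤ {f = avoid} avoid-injective))
  where
  -- f misses j, so it factors injectively through Fin b'
  avoid : Fin (suc b') → Fin b'
  avoid i = F.punchOut {i = j} {j = f i} (λ e → miss (i , sym e))
  avoid-injective : ∀ {x y} → avoid x ≡ avoid y → x ≡ y
  avoid-injective {x} {y} e =
    inj x y (FP.punchOut-injective {i = j} (λ e → miss (x , sym e)) (λ e → miss (y , sym e)) e)

injective⇒bijection : ∀ {a b} → a ≡ b → (f : Fin a → Fin b) → (∀ x y → f x ≡ f y → x ≡ y) → Fin a ↔ Fin b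
injective⇒bijection e f inj = mk↔ₛ′ f (λ j → proj₁ (injective⇒surjective e f inj j))
  (λ j → proj₂ (injective⇒surjective e f inj j))
  (λ x → inj _ _ (proj₂ (injective⇒surjective e f inj (f x))))

module JoinAdjacency (l : ℕ) where
  private
    k = 2 * l ∸ 1

    <ᵇℕ-true : ∀ {a b} → a < b → ⌊ a <? b ⌋ ≡ true
    <ᵇℕ-true {a} {b} p with a <? b
    ... | yes _ = refl
    ... | no n = ⊥-elim (n p)

    <ᵇℕ-false : ∀ {a b} → b ≤ a → ⌊ a <? b ⌋ ≡ false
    <ᵇℕ-false {a} {b} p with a <? b
    ... | yes q = ⊥-elim (<⇒≱ q p)
    ... | no n = refl

  join-low-low : ∀ a b → a < k → b < k → joinAdjℕ l a b ≡ false
  join-low-low a b pa pb rewrite <ᵇℕ-true pa | <ᵇℕ-true pb = BP.∧-zeroʳ _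

  join-low-high : ∀ a b → a < k → k ≤ b → joinAdjℕ l a b ≡ true
  join-low-high a b pa pb rewrite <ᵇℕ-true pa | <ᵇℕ-false pb with a ℕ.≟ b
  ... | yes refl = ⊥-elim (<⇒≱ pa pb)
  ... | no _ = refl

  join-high-low : ∀ a b → k ≤ a → b < k → joinAdjℕ l a b ≡ true
  join-high-low a b pa pb rewrite <ᵇℕ-false pa | <ᵇℕ-true pb with a ℕ.≟ b
  ... | yes refl = ⊥-elim (<⇒≱ pb pa)
  ... | no _ = refl

  join-high-high : ∀ a b → k ≤ a → k ≤ b →
    joinAdjℕ l a b ≡ (not ⌊ a ℕ.≟ b ⌋ ∧ ⌊ ⌊ (a ∸ k) /2⌋ ℕ.≟ ⌊ (b ∸ k) /2⌋ ⌋)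
  join-high-high a b pa pb rewrite <ᵇℕ-false pa | <ᵇℕ-false pb = refl

≟ℕ-false : ∀ {a b : ℕ} → ¬ a ≡ b → ⌊ a ℕ.≟ b ⌋ ≡ false
≟ℕ-false {a} {b} ne with a ℕ.≟ b
... | yes e = ⊥-elim (ne e)
... | no _ = refl

≟ℕ-true : ∀ {a b : ℕ} → a ≡ b → ⌊ a ℕ.≟ b ⌋ ≡ true
≟ℕ-true {a} {b} e with a ℕ.≟ b
... | yes _ = refl
... | no ne = ⊥-elim (ne e)

half-2i+bit : ∀ i p → ⌊ (2 * i + b2n p) /2⌋ ≡ i
half-2i+bit zero true = refl
half-2i+bit zero false = refl
half-2i+bit (suc i) p = trans (cong ⌊_/2⌋ (shape i (b2n p))) (cong suc (half-2i+bit i p))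
  where
  shape : ∀ i x → 2 * suc i + x ≡ suc (suc (2 * i + x))
  shape = solve-∀

2i+bit-injective : ∀ a b p q → 2 * a + b2n p ≡ 2 * b + b2n q → (a ≡ b) × (p ≡ q)
2i+bit-injective a b p q e = a≡b , bits (trans e (cong (λ z → 2 * z + b2n q) (sym a≡b)))
  where
  a≡b : a ≡ b
  a≡b = trans (sym (half-2i+bit a p)) (trans (cong ⌊_/2⌋ e) (half-2i+bit b q))
  bits : ∀ {p q} → 2 * a + b2n p ≡ 2 * a + b2n q → p ≡ q
  bits {true} {true} _ = refl
  bits {false} {false} _ = refl
  bits {true} {false} e' = ⊥-elim (1+n≢n (trans (+-comm 1 (2 * a)) (trans e' (+-identityʳ _))))
  bits {false} {true} e' = ⊥-elim (1+n≢n (sym (trans (sym (+-identityʳ _)) (trans e' (+-comm (2 * a) 1)))))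

rank : ∀ {m} → (Fin m → Bool) → Fin m → ℕ
rank Q v = ∑ (λ z → b2n ((z <ᵇ v) ∧ Q z))

rank<sum : ∀ {m} (Q R : Fin m → Bool) v → Q v ≡ true → (∀ z → z F.< v → R z ≡ true) → R v ≡ true →
  rank Q v < ∑ (λ z → b2n (R z ∧ Q z))
rank<sum Q R v qv below rv = ≤-trans (≤-reflexive (sym with-v)) (∑-mono pointwise)
  where
  self : ∑ (λ z → b2n ((z == v) ∧ Q z)) ≡ b2n (Q v)
  self = trans (∑-cong pick) (∑-delta v (λ z → b2n (Q z)))
    where
    pick : ∀ z → b2n ((z == v) ∧ Q z) ≡ (if (z == v) then b2n (Q z) else 0)
    pick z with z == v
    ... | true = refl
    ... | false = refl
  with-v : ∑ (λ z → b2n ((z <ᵇ v) ∧ Q z) + b2n ((z == v) ∧ Q z)) ≡ suc (rank Q v)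
  with-v = trans (∑-+ _ _) (trans (cong (rank Q v +_) (trans self (cong b2n qv))) (+-comm _ 1))
  pointwise : ∀ z → b2n ((z <ᵇ v) ∧ Q z) + b2n ((z == v) ∧ Q z) ≤ b2n (R z ∧ Q z)
  pointwise z with FP.<-cmp z v
  ... | tri< p _ _ rewrite <ᵇ-true p | below z p with z F.≟ v
  ... | yes e' = ⊥-elim (FP.<⇒≢ p e')
  ... | no _ = ≤-reflexive (+-identityʳ _)
  pointwise z | tri≈ _ refl _ rewrite <ᵇ-irrefl z | rv with z F.≟ z
  ... | yes _ = ≤-refl
  ... | no n = ⊥-elim (n refl)
  pointwise z | tri> _ _ p rewrite <ᵇ-false (FP.<-asym p) with z F.≟ v
  ... | yes e' = ⊥-elim (FP.<⇒≢ p (sym e'))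
  ... | no _ = z≤n

rank<count : ∀ {m} (Q : Fin m → Bool) v → Q v ≡ true → rank Q v < count Q
rank<count Q v qv = rank<sum Q (λ _ → true) v qv (λ _ _ → refl) refl

rank-mono : ∀ {m} (Q : Fin m → Bool) v w → Q v ≡ true → v F.< w → rank Q v < rank Q w
rank-mono Q v w qv p = rank<sum Q (_<ᵇ w) v qv (λ z q → <ᵇ-true (FP.<-trans q p)) (<ᵇ-true p)

rank-injective : ∀ {m} (Q : Fin m → Bool) v w → Q v ≡ true → Q w ≡ true → rank Q v ≡ rank Q w → v ≡ w
rank-injective Q v w qv qw e with FP.<-cmp v w
... | tri< p _ _ = ⊥-elim (<-irrefl e (rank-mono Q v w qv p))
... | tri≈ _ e' _ = e'
... | tri> _ _ p = ⊥-elim (<-irrefl (sym e) (rank-mono Q w v qw p))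

-- Given a join structure with independent part P, the vertices outside P are
-- matched in pairs {v, partner v}; calling the smaller one of each pair its leader,
-- the labelling
--     v ∈ P ↦ rank of v in P,   v ∉ P ↦ (2l − 1) + 2·(rank of its leader) + bit,
-- is an isomorphism onto JoinGraph l.
module JoinRecognition {m : ℕ} (H : Graph m) (P : Fin m → Bool)
  (independent : ∀ u v → P u ≡ true → P v ≡ true → adj H u v ≡ false)
  (joined : ∀ u v → P u ≡ true → P v ≡ false → adj H u v ≡ true)
  (matching : ∀ v → P v ≡ false → ∑ (λ w → b2n (adj H v w ∧ not (P w))) ≡ 1)
  (sizes : count P + 1 ≡ count (∁ P)) where

  outsideNeighbour : Fin m → Fin m → Bool
  outsideNeighbour v w = adj H v w ∧ not (P w)

  choosePartner : Fin m → Fin m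
  choosePartner v with FP.any? (λ w → outsideNeighbour v w BP.≟ true)
  ... | yes (w , _) = w
  ... | no _ = v

  choosePartner-spec : ∀ v → P v ≡ false → outsideNeighbour v (choosePartner v) ≡ true
  choosePartner-spec v pv with FP.any? (λ w → outsideNeighbour v w BP.≟ true)
  ... | yes (w , e) = e
  ... | no none = ⊥-elim (0≢1+n (trans (sym (trans (∑-cong no-edge) (∑-zeros {m}))) (matching v pv)))
    where
    no-edge : ∀ w → b2n (outsideNeighbour v w) ≡ 0
    no-edge w with outsideNeighbour v w in e
    ... | true = ⊥-elim (none (w , e))
    ... | false = refl

  opaque
    partner : Fin m → Fin m
    partner v = if P v then v else choosePartner v

    partner-P : ∀ v → P v ≡ true → partner v ≡ v
    partner-P v e rewrite e = refl

    partner-∁P : ∀ v → P v ≡ false → partner v ≡ choosePartner v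
    partner-∁P v e rewrite e = refl

  outsideNeighbour-parts : ∀ {v w} → outsideNeighbour v w ≡ true → (adj H v w ≡ true) × (P w ≡ false)
  outsideNeighbour-parts {v} {w} e with adj H v w | P w
  ... | true | false = refl , refl
  outsideNeighbour-parts () | true | true
  outsideNeighbour-parts () | false | _

  partner-adj : ∀ v → P v ≡ false → adj H v (partner v) ≡ true
  partner-adj v pv rewrite partner-∁P v pv = proj₁ (outsideNeighbour-parts (choosePartner-spec v pv))

  partner-∁ : ∀ v → P v ≡ false → P (partner v) ≡ false
  partner-∁ v pv rewrite partner-∁P v pv = proj₂ (outsideNeighbour-parts (choosePartner-spec v pv))

  partner-unique : ∀ v w → P v ≡ false → adj H v w ≡ true → P w ≡ false → w ≡ partner v
  partner-unique v w pv a pw with w F.≟ partner v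
  ... | yes e = e
  ... | no ne = ⊥-elim (<-irrefl refl (≤-trans two (≤-reflexive (matching v pv))))
    where
    one-w : b2n (outsideNeighbour v w) ≡ 1
    one-w rewrite a | pw = refl
    one-partner : b2n (outsideNeighbour v (partner v)) ≡ 1
    one-partner rewrite partner-adj v pv | partner-∁ v pv = refl
    two : 2 ≤ ∑ (λ u → b2n (outsideNeighbour v u))
    two = subst (_≤ ∑ (λ u → b2n (outsideNeighbour v u))) (cong₂ _+_ one-w one-partner)
            (∑-two (λ u → b2n (outsideNeighbour v u)) w (partner v) ne)

  partner-involutive : ∀ v → partner (partner v) ≡ v
  partner-involutive v with bool-cases (P v)
  ... | inj₁ pv = trans (cong partner (partner-P v pv)) (partner-P v pv)
  ... | inj₂ pv = sym (partner-unique (partner v) v (partner-∁ v pv)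
                         (trans (adj-sym H (partner v) v) (partner-adj v pv)) pv)

  partner-≢ : ∀ v → P v ≡ false → ¬ partner v ≡ v
  partner-≢ v pv e = true≢false (trans (sym (partner-adj v pv)) (trans (cong (adj H v) e) (adj-irr H v)))

  partner-order : ∀ v → P v ≡ false → (partner v <ᵇ v) ≡ not (v <ᵇ partner v)
  partner-order v pv = <ᵇ-flip v (partner v) (λ e → partner-≢ v pv (sym e))

  leader : Fin m → Bool
  leader v = not (P v) ∧ (v <ᵇ partner v)

  follower : Fin m → Bool
  follower v = not (P v) ∧ (partner v <ᵇ v)

  follower≡leader∘partner : ∀ v → follower v ≡ leader (partner v)
  follower≡leader∘partner v with bool-cases (P v)
  ... | inj₁ pv = trans (cong (λ a → not a ∧ (partner v <ᵇ v)) pv)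
                   (sym (cong (λ a → not a ∧ (partner v <ᵇ partner (partner v))) (trans (cong P (partner-P v pv)) pv)))
  ... | inj₂ pv = cong₂ (λ a b → not a ∧ (partner v <ᵇ b)) (trans pv (sym (partner-∁ v pv))) (sym (partner-involutive v))

  l : ℕ
  l = count leader

  -- Outside P every vertex is a leader or a follower, and partner swaps the two.
  |∁P|≡2l : count (∁ P) ≡ 2 * l
  |∁P|≡2l = begin
      count (∁ P) ≡⟨ ∑-cong one-of-two ⟩
      ∑ (λ v → b2n (leader v) + b2n (follower v)) ≡⟨ ∑-+ _ _ ⟩
      l + count follower
        ≡⟨ cong (l +_) (trans (∑-cong (λ v → cong b2n (follower≡leader∘partner v)))
                              (∑-involution partner partner-involutive (λ v → b2n (leader v)))) ⟩
      l + l ≡⟨ cong (l +_) (sym (+-identityʳ _)) ⟩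
      2 * l ∎
    where
    open ≡-Reasoning
    one-of-two : ∀ v → b2n (not (P v)) ≡ b2n (leader v) + b2n (follower v)
    one-of-two v with bool-cases (P v)
    ... | inj₁ pv rewrite pv = refl
    ... | inj₂ pv rewrite pv | partner-order v pv with v <ᵇ partner v
    ... | true = refl
    ... | false = refl

  leaderOf : Fin m → Fin m
  leaderOf v = if v <ᵇ partner v then v else partner v

  leaderOf-self : ∀ v → (v <ᵇ partner v) ≡ true → leaderOf v ≡ v
  leaderOf-self v e = cong (λ b → if b then v else partner v) e

  leaderOf-partner : ∀ v → (v <ᵇ partner v) ≡ false → leaderOf v ≡ partner v
  leaderOf-partner v e = cong (λ b → if b then v else partner v) e

  partner-order' : ∀ v → P v ≡ false → ∀ {b} → (v <ᵇ partner v) ≡ b → (partner v <ᵇ partner (partner v)) ≡ not b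
  partner-order' v pv e = trans (cong (partner v <ᵇ_) (partner-involutive v)) (trans (partner-order v pv) (cong not e))

  leaderOf-leader : ∀ v → P v ≡ false → leader (leaderOf v) ≡ true
  leaderOf-leader v pv with bool-cases (v <ᵇ partner v)
  ... | inj₁ e = trans (cong leader (leaderOf-self v e)) (cong₂ (λ a b → not a ∧ b) pv e)
  ... | inj₂ e = trans (cong leader (leaderOf-partner v e)) (cong₂ (λ a b → not a ∧ b) (partner-∁ v pv) (partner-order' v pv e))

  leaderOf-partner-invariant : ∀ v → P v ≡ false → leaderOf (partner v) ≡ leaderOf v
  leaderOf-partner-invariant v pv with bool-cases (v <ᵇ partner v)
  ... | inj₁ e = trans (leaderOf-partner (partner v) (partner-order' v pv e)) (trans (partner-involutive v) (sym (leaderOf-self v e)))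
  ... | inj₂ e = trans (leaderOf-self (partner v) (partner-order' v pv e)) (sym (leaderOf-partner v e))

  leaderOf-cases : ∀ v → (leaderOf v ≡ v) ⊎ (leaderOf v ≡ partner v)
  leaderOf-cases v with bool-cases (v <ᵇ partner v)
  ... | inj₁ e = inj₁ (leaderOf-self v e)
  ... | inj₂ e = inj₂ (leaderOf-partner v e)

  same-leader : ∀ x y → leaderOf x ≡ leaderOf y → (y ≡ x) ⊎ (y ≡ partner x)
  same-leader x y e with leaderOf-cases x | leaderOf-cases y
  ... | inj₁ ex | inj₁ ey = inj₁ (trans (sym ey) (trans (sym e) ex))
  ... | inj₁ ex | inj₂ ey = inj₂ (trans (sym (partner-involutive y)) (cong partner (trans (sym ey) (trans (sym e) ex))))
  ... | inj₂ ex | inj₁ ey = inj₂ (trans (sym ey) (trans (sym e) ex))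
  ... | inj₂ ex | inj₂ ey = inj₁ (trans (sym (partner-involutive y))
                              (trans (cong partner (trans (sym ey) (trans (sym e) ex))) (partner-involutive x)))

  pair-rank : Fin m → ℕ
  pair-rank v = rank leader (leaderOf v)

  same-pair-rank : ∀ x y → P x ≡ false → P y ≡ false → pair-rank x ≡ pair-rank y → (y ≡ x) ⊎ (y ≡ partner x)
  same-pair-rank x y px py r =
    same-leader x y (rank-injective leader (leaderOf x) (leaderOf y) (leaderOf-leader x px) (leaderOf-leader y py) r)

  K : ℕ
  K = 2 * l ∸ 1

  M : ℕ
  M = K + 2 * l

  |P|≡K : count P ≡ K
  |P|≡K = trans (sym (m+n∸n≡m (count P) 1)) (cong (_∸ 1) (trans sizes |∁P|≡2l))

  l≥1 : 1 ≤ l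
  l≥1 with l in el
  ... | zero = ⊥-elim (1+n≢0 (trans (+-comm 1 (count P)) (trans (trans sizes |∁P|≡2l) (cong (2 *_) el))))
  ... | suc _ = s≤s z≤n

  m≡M : m ≡ M
  m≡M = trans (sym (count-∁ P)) (cong₂ _+_ |P|≡K |∁P|≡2l)

  bit : Fin m → ℕ
  bit v = b2n (partner v <ᵇ v)

  opaque
    label : Fin m → ℕ
    label v = if P v then rank P v else K + (2 * pair-rank v + bit v)

    label-P : ∀ v → P v ≡ true → label v ≡ rank P v
    label-P v e = cong (λ b → if b then rank P v else K + (2 * pair-rank v + bit v)) e

    label-∁P : ∀ v → P v ≡ false → label v ≡ K + (2 * pair-rank v + bit v)
    label-∁P v e = cong (λ b → if b then rank P v else K + (2 * pair-rank v + bit v)) e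

  label-P<K : ∀ v → P v ≡ true → label v < K
  label-P<K v e = subst (_< K) (sym (label-P v e)) (subst (rank P v <_) |P|≡K (rank<count P v e))

  label-∁P≥K : ∀ v → P v ≡ false → K ≤ label v
  label-∁P≥K v e = subst (K ≤_) (sym (label-∁P v e)) (m≤m+n K _)

  label<M : ∀ v → label v < M
  label<M v with bool-cases (P v)
  ... | inj₁ e = ≤-trans (label-P<K v e) (m≤m+n K (2 * l))
  ... | inj₂ e = subst (_< M) (sym (label-∁P v e)) (+-monoʳ-< K offset<2l)
    where
    r = pair-rank v
    r<l : r < l
    r<l = rank<count leader (leaderOf v) (leaderOf-leader v e)
    offset<2l : 2 * r + bit v < 2 * l
    offset<2l = ≤-trans (≤-reflexive (sym (+-suc (2 * r) (bit v))))
                  (≤-trans (+-monoʳ-≤ (2 * r) (s≤s (b2n≤1 (partner v <ᵇ v))))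
                    (≤-trans (≤-reflexive (trans (+-comm (2 * r) 2) (sym (*-suc 2 r)))) (*-monoʳ-≤ 2 r<l)))

  label-injective : ∀ x y → label x ≡ label y → x ≡ y
  label-injective x y e with bool-cases (P x) | bool-cases (P y)
  ... | inj₁ px | inj₁ py = rank-injective P x y px py (trans (sym (label-P x px)) (trans e (label-P y py)))
  ... | inj₁ px | inj₂ py = ⊥-elim (<⇒≱ (label-P<K x px) (subst (K ≤_) (sym e) (label-∁P≥K y py)))
  ... | inj₂ px | inj₁ py = ⊥-elim (<⇒≱ (label-P<K y py) (subst (K ≤_) e (label-∁P≥K x px)))
  ... | inj₂ px | inj₂ py = from-parts (2i+bit-injective (pair-rank x) (pair-rank y) (partner x <ᵇ x) (partner y <ᵇ y)
                                   (+-cancelˡ-≡ K _ _ (trans (sym (label-∁P x px)) (trans e (label-∁P y py)))))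
    where
    b≢not-b : ∀ b → b ≡ not b → ⊥
    b≢not-b true ()
    b≢not-b false ()
    from-parts : (pair-rank x ≡ pair-rank y) × ((partner x <ᵇ x) ≡ (partner y <ᵇ y)) → x ≡ y
    from-parts (r , bits) with same-pair-rank x y px py r
    ... | inj₁ y≡x = sym y≡x
    ... | inj₂ y≡px = ⊥-elim (b≢not-b (x <ᵇ partner x) (trans (sym swapped) (partner-order x px)))
      where
      -- y = partner x would carry the opposite bit
      swapped : (partner x <ᵇ x) ≡ (x <ᵇ partner x)
      swapped = trans bits (cong₂ _<ᵇ_ (trans (cong partner y≡px) (partner-involutive x)) y≡px)

  label-half : ∀ v → P v ≡ false → ⌊ (label v ∸ K) /2⌋ ≡ pair-rank v
  label-half v pv = trans (cong (λ z → ⌊ (z ∸ K) /2⌋) (label-∁P v pv))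
    (trans (cong ⌊_/2⌋ (m+n∸m≡n K _)) (half-2i+bit (pair-rank v) (partner v <ᵇ v)))

  adj-outside : ∀ x y → P x ≡ false → P y ≡ false →
    adj H x y ≡ (not ⌊ label x ℕ.≟ label y ⌋ ∧ ⌊ pair-rank x ℕ.≟ pair-rank y ⌋)
  adj-outside x y px py with y F.≟ partner x
  ... | yes e = trans (trans (cong (adj H x) e) (partner-adj x px))
                  (sym (cong₂ (λ a b → not a ∧ b) (≟ℕ-false distinct) (≟ℕ-true same)))
    where
    distinct : ¬ label x ≡ label y
    distinct q = partner-≢ x px (trans (sym e) (sym (label-injective x y q)))
    same : pair-rank x ≡ pair-rank y
    same = cong (rank leader) (trans (sym (leaderOf-partner-invariant x px)) (cong leaderOf (sym e)))
  ... | no ne = trans not-adjacent (sym different-pairs)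
    where
    not-adjacent : adj H x y ≡ false
    not-adjacent with bool-cases (adj H x y)
    ... | inj₁ a = ⊥-elim (ne (partner-unique x y px a py))
    ... | inj₂ a = a
    different-pairs : (not ⌊ label x ℕ.≟ label y ⌋ ∧ ⌊ pair-rank x ℕ.≟ pair-rank y ⌋) ≡ false
    different-pairs with label x ℕ.≟ label y
    ... | yes _ = refl
    ... | no differ with pair-rank x ℕ.≟ pair-rank y
    ... | no _ = refl
    ... | yes r with same-pair-rank x y px py r
    ... | inj₁ y≡x = ⊥-elim (differ (cong label (sym y≡x)))
    ... | inj₂ y≡px = ⊥-elim (ne y≡px)

  open JoinAdjacency l

  adj≡join : ∀ x y → adj H x y ≡ joinAdjℕ l (label x) (label y)
  adj≡join x y with bool-cases (P x) | bool-cases (P y)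
  ... | inj₁ px | inj₁ py =
    trans (independent x y px py) (sym (join-low-low (label x) (label y) (label-P<K x px) (label-P<K y py)))
  ... | inj₁ px | inj₂ py =
    trans (joined x y px py) (sym (join-low-high (label x) (label y) (label-P<K x px) (label-∁P≥K y py)))
  ... | inj₂ px | inj₁ py =
    trans (trans (adj-sym H x y) (joined y x py px)) (sym (join-high-low (label x) (label y) (label-∁P≥K x px) (label-P<K y py)))
  ... | inj₂ px | inj₂ py = trans (adj-outside x y px py)
    (sym (trans (join-high-high (label x) (label y) (label-∁P≥K x px) (label-∁P≥K y py))
      (cong₂ (λ a b → not ⌊ label x ℕ.≟ label y ⌋ ∧ ⌊ a ℕ.≟ b ⌋) (label-half x px) (label-half y py))))

  ≅join : Σ ℕ λ l' → (1 ≤ l') × (H ≅ JoinGraph l')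
  ≅join = l , l≥1 , injective⇒bijection m≡M labelFin labelFin-injective ,
          λ x y → trans (adj≡join x y) (sym (cong₂ (joinAdjℕ l) (toℕ-labelFin x) (toℕ-labelFin y)))
    where
    labelFin : Fin m → Fin M
    labelFin v = fromℕ< (label<M v)
    toℕ-labelFin : ∀ v → toℕ (labelFin v) ≡ label v
    toℕ-labelFin v = FP.toℕ-fromℕ< (label<M v)
    labelFin-injective : ∀ x y → labelFin x ≡ labelFin y → x ≡ y
    labelFin-injective x y e = label-injective x y (trans (sym (toℕ-labelFin x)) (trans (cong toℕ e) (toℕ-labelFin y)))

joinStructure⇒≅join : ∀ {m} (H : Graph m) → JoinStructure H → Σ ℕ λ l → (1 ≤ l) × (H ≅ JoinGraph l)
joinStructure⇒≅join H (P , independent , joined , matching , sizes) =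
  JoinRecognition.≅join H P independent joined matching sizes

noEdges : ∀ {n} (G : Graph n) → EdgeSet G
noEdges G = record { mem = λ _ _ → false ; mem-sym = λ _ _ → refl ; mem-sub = λ _ _ () }

size-noEdges : ∀ {n} (G : Graph n) → size (noEdges G) ≡ 0
size-noEdges {n} G = trans (size≡unordered (noEdges G))
  (trans (∑-cong (λ x → trans (∑-cong (λ y → cong b2n (BP.∧-zeroʳ _))) (∑-zeros {n}))) (∑-zeros {n}))

noEdges-minimum : ∀ {n} (G : Graph n) (Y : Fin n → Bool) → Closed (adj G) Y →
  ∀ a b → Y a ≡ true → Y b ≡ false → IsMinEdgeCut G (noEdges G)
noEdges-minimum G Y cl a b ya yb = cut , λ T _ → subst (_≤ size T) (sym (size-noEdges G)) z≤n
  where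
  cut : IsEdgeCut G (noEdges G)
  cut = closed⇒disconnected _ Y (λ p q r yp → cl p q (trans (sym (BP.∧-identityʳ _)) r) yp) a b ya yb

module Star {k} (K : Graph k) (w : Fin k) where

  star : EdgeSet K
  star = record
    { mem = λ p q → adj K p q ∧ ((p == w) ∨ (q == w))
    ; mem-sym = λ p q → cong₂ _∧_ (adj-sym K p q) (BP.∨-comm (p == w) (q == w))
    ; mem-sub = λ p q e → ∧-elimˡ e }

  star-cut : ∀ w' → ¬ w' ≡ w → IsEdgeCut K star
  star-cut w' ne c = isolated (c w w')
    where
    no-exit : ∀ y → removeEdges K star w y ≡ false
    no-exit y rewrite ==-refl w with adj K w y
    ... | true = refl
    ... | false = refl
    isolated : Walk (removeEdges K star) w w' → ⊥
    isolated here = ne refl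
    isolated (step r _) = true≢false (trans (sym r) (no-exit _))

  ordered-star : ordered (mem star) ≡ 2 * deg K w
  ordered-star = begin
      ordered (mem star) ≡⟨ ∑-cong (λ p → trans (∑-cong (split p)) (∑-+ _ _)) ⟩
      ∑ (λ p → ∑ (λ q → if p == w then b2n (adj K p q) else 0) + ∑ (λ q → if q == w then b2n (adj K p q) else 0))
        ≡⟨ ∑-+ _ _ ⟩
      ∑ (λ p → ∑ (λ q → if p == w then b2n (adj K p q) else 0)) + ∑ (λ p → ∑ (λ q → if q == w then b2n (adj K p q) else 0))
        ≡⟨ cong₂ _+_ (trans (∑-cong pull) (∑-delta w (λ p → ∑ (λ q → b2n (adj K p q)))))
                     (∑-cong (λ p → ∑-delta w (λ q → b2n (adj K p q)))) ⟩
      ∑ (λ q → b2n (adj K w q)) + ∑ (λ p → b2n (adj K p w))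
        ≡⟨ cong₂ _+_ (sym (deg-∑ K w)) (trans (∑-cong (λ p → cong b2n (adj-sym K p w))) (sym (deg-∑ K w))) ⟩
      deg K w + deg K w ≡⟨ cong (deg K w +_) (sym (+-identityʳ _)) ⟩
      2 * deg K w ∎
    where
    open ≡-Reasoning
    split : ∀ p q → b2n (adj K p q ∧ ((p == w) ∨ (q == w))) ≡
      (if p == w then b2n (adj K p q) else 0) + (if q == w then b2n (adj K p q) else 0)
    split p q with p F.≟ w | q F.≟ w
    ... | yes refl | yes refl rewrite adj-irr K p = refl
    ... | yes _ | no _ rewrite BP.∧-identityʳ (adj K p q) = sym (+-identityʳ _)
    ... | no _ | yes _ rewrite BP.∧-identityʳ (adj K p q) = refl
    ... | no _ | no _ rewrite BP.∧-zeroʳ (adj K p q) = refl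
    pull : ∀ p → ∑ (λ q → if p == w then b2n (adj K p q) else 0) ≡ (if p == w then ∑ (λ q → b2n (adj K p q)) else 0)
    pull p with p == w
    ... | true = refl
    ... | false = ∑-zeros {k}

  size-star : size star ≡ deg K w
  size-star = *-cancelˡ-≡ _ _ 2 (trans (sym (ordered≡2*size star)) ordered-star)

module Product {n m : ℕ} (G : Graph n) (H : Graph m) where
  open CrossingCounts H

  GH : Graph (n * m)
  GH = G ×ᵍ H

  pair : Fin n → Fin m → Fin (n * m)
  pair = combine {n} {m}

  coordG : Fin (n * m) → Fin n
  coordG p = proj₁ (remQuot {n} m p)

  coordH : Fin (n * m) → Fin m
  coordH p = proj₂ (remQuot {n} m p)

  coordG-pair : ∀ x u → coordG (pair x u) ≡ x
  coordG-pair x u = cong proj₁ (FP.remQuot-combine {n} {m} x u)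

  coordH-pair : ∀ x u → coordH (pair x u) ≡ u
  coordH-pair x u = cong proj₂ (FP.remQuot-combine {n} {m} x u)

  pair-coords : ∀ p → pair (coordG p) (coordH p) ≡ p
  pair-coords p = FP.combine-remQuot {n} m p

  pair-== : ∀ a i b j → (pair a i == pair b j) ≡ ((a == b) ∧ (i == j))
  pair-== a i b j with pair a i F.≟ pair b j | a F.≟ b | i F.≟ j
  ... | yes e | yes _ | yes _ = refl
  ... | yes e | no a≢b | _ = ⊥-elim (a≢b (FP.combine-injectiveˡ a i b j e))
  ... | yes e | yes _ | no i≢j = ⊥-elim (i≢j (FP.combine-injectiveʳ a i b j e))
  ... | no ne | yes refl | yes refl = ⊥-elim (ne refl)
  ... | no ne | yes _ | no _ = refl
  ... | no ne | no _ | _ = refl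

  fibre : (Fin (n * m) → Bool) → Fin n → Fin m → Bool
  fibre X x u = X (pair x u)

  boundary : (Fin (n * m) → Bool) → EdgeSet GH
  boundary X = record
    { mem = λ p q → prodAdj G H p q ∧ (X p xor X q)
    ; mem-sym = λ p q → cong₂ _∧_ (prod-sym G H p q) (BP.xor-comm (X p) (X q))
    ; mem-sub = λ p q e → ∧-elimˡ e }

  boundary-cut : ∀ X a b → X a ≡ true → X b ≡ false → IsEdgeCut GH (boundary X)
  boundary-cut X = closed⇒disconnected _ X (λ p q r xp → trans (sym (same-side p q r)) xp)
    where
    same-side : ∀ p q → removeEdges GH (boundary X) p q ≡ true → X p ≡ X q
    same-side p q r with bool-cases (prodAdj G H p q) | bool-cases (X p xor X q)
    ... | _ | inj₂ x = xor-false (X p) (X q) x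
    ... | inj₁ a | inj₁ x rewrite a | x = ⊥-elim (true≢false (sym r))
    ... | inj₂ a | inj₁ x rewrite a = ⊥-elim (true≢false (sym r))

  ordered-boundary : ∀ X → ordered (mem (boundary X)) ≡
    ∑ (λ x → ∑ (λ y → b2n (adj G x y) * cross (fibre X x) (fibre X y)))
  ordered-boundary X = trans (ordered-combine {n} {m} _)
    (trans (∑-cong (λ x → ∑-cong (λ u → ∑-cong (λ y → ∑-cong (λ v →
        cong b2n (trans (cong (_∧ (fibre X x u xor fibre X y v)) (prodAdj-combine G H x u y v))
                        (BP.∧-assoc (adj G x y) (adj H u v) _)))))))
      (∑-factor-edges (adj G) (λ x u y v → adj H u v ∧ (fibre X x u xor fibre X y v))))

  ordered-H : ℕ
  ordered-H = ∑ (λ u → ∑ (λ v → b2n (adj H u v)))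

  induced : EdgeSet G → EdgeSet GH
  induced T = record
    { mem = λ p q → mem T (coordG p) (coordG q) ∧ adj H (coordH p) (coordH q)
    ; mem-sym = λ p q → cong₂ _∧_ (mem-sym T (coordG p) (coordG q)) (adj-sym H (coordH p) (coordH q))
    ; mem-sub = λ p q e → cong₂ _∧_ (mem-sub T (coordG p) (coordG q) (∧-elimˡ e)) (∧-elimʳ e) }

  ordered-induced : ∀ T → ordered (mem (induced T)) ≡ ordered (mem T) * ordered-H
  ordered-induced T = trans (ordered-combine {n} {m} _)
    (trans (∑-cong (λ x → ∑-cong (λ u → ∑-cong (λ y → ∑-cong (λ v → in-coordinates x u y v)))))
      (trans (∑-factor-edges (mem T) (λ x u y v → adj H u v))
        (trans (∑-cong (λ x → ∑-*ʳ ordered-H _)) (∑-*ʳ ordered-H _))))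
    where
    in-coordinates : ∀ x u y v →
      b2n (mem T (coordG (pair x u)) (coordG (pair y v)) ∧ adj H (coordH (pair x u)) (coordH (pair y v)))
      ≡ b2n (mem T x y ∧ adj H u v)
    in-coordinates x u y v =
      trans (cong₂ (λ a b → b2n (mem T a b ∧ adj H (coordH (pair x u)) (coordH (pair y v)))) (coordG-pair x u) (coordG-pair y v))
            (cong₂ (λ a b → b2n (mem T x y ∧ adj H a b)) (coordH-pair x u) (coordH-pair y v))

  -- A cut T of G induces a cut of G × H: walks avoiding the induced set project to G − T.
  induced-cut : Fin m → ∀ T → IsEdgeCut G T → IsEdgeCut GH (induced T)
  induced-cut u₀ T cutT connected = cutT λ x y →
    subst₂ (Walk (removeEdges G T)) (coordG-pair x u₀) (coordG-pair y u₀)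
      (walk-map coordG (λ p q r → project (adj G (coordG p) (coordG q)) (adj H (coordH p) (coordH q))
                                     (mem T (coordG p) (coordG q)) r)
        (connected (pair x u₀) (pair y u₀)))
    where
    project : ∀ a b c → (a ∧ b) ∧ not (c ∧ b) ≡ true → a ∧ not c ≡ true
    project true true false _ = refl

  deg-product : ∀ x u → deg GH (pair x u) ≡ deg G x * deg H u
  deg-product x u = begin
      deg GH (pair x u) ≡⟨ deg-∑ GH (pair x u) ⟩
      ∑ (λ q → b2n (prodAdj G H (pair x u) q)) ≡⟨ ∑-combine {n} {m} _ ⟩
      ∑ (λ y → ∑ (λ v → b2n (prodAdj G H (pair x u) (pair y v))))
        ≡⟨ ∑-cong (λ y → trans (∑-cong (λ v → trans (cong b2n (prodAdj-combine G H x u y v)) (b2n-∧ (adj G x y) (adj H u v))))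
                          (∑-*ˡ (b2n (adj G x y)) _)) ⟩
      ∑ (λ y → b2n (adj G x y) * ∑ (λ v → b2n (adj H u v))) ≡⟨ ∑-*ʳ _ _ ⟩
      ∑ (λ y → b2n (adj G x y)) * ∑ (λ v → b2n (adj H u v)) ≡⟨ sym (cong₂ _*_ (deg-∑ G x) (deg-∑ H u)) ⟩
      deg G x * deg H u ∎
    where open ≡-Reasoning

argmin : ∀ {k} (g : Fin k → ℕ) → Fin k → Σ (Fin k) λ i → ∀ j → g i ≤ g j
argmin {suc zero} g _ = F.zero , λ { F.zero → ≤-refl }
argmin {suc (suc k)} g _ with argmin (λ j → g (F.suc j)) F.zero
... | i , h with g F.zero ≤? g (F.suc i)
... | yes le = F.zero , λ { F.zero → ≤-refl ; (F.suc j) → ≤-trans le (h j) }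
... | no nle = F.suc i , λ { F.zero → <⇒≤ (≰⇒> nle) ; (F.suc j) → h j }

offDiagonalAt : ∀ {k} → (Fin k → Fin k → ℕ) → Fin k → ℕ
offDiagonalAt W x = ∑ (λ z → ∑ (λ y → if (z == x) ∨ (y == x) then 0 else W z y))

∑∑-around : ∀ {k} (W : Fin k → Fin k → ℕ) (x : Fin k) → (∀ z y → W z y ≡ W y z) → W x x ≡ 0 →
  ∑ (λ z → ∑ (λ y → W z y)) ≡ 2 * ∑ (λ y → W x y) + offDiagonalAt W x
∑∑-around {k} W x symm diag = begin
    ∑ (λ z → ∑ (λ y → W z y))
      ≡⟨ ∑-cong (λ z → trans (∑-cong (λ y → parts z y)) (trans (∑-+ _ _) (cong (_+ ∑ (λ y → rest z y)) (∑-+ _ _)))) ⟩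
    ∑ (λ z → (∑ (λ y → row z y) + ∑ (λ y → column z y)) + ∑ (λ y → rest z y))
      ≡⟨ trans (∑-+ _ _) (cong (_+ offDiagonalAt W x) (∑-+ _ _)) ⟩
    (∑ (λ z → ∑ (λ y → row z y)) + ∑ (λ z → ∑ (λ y → column z y))) + offDiagonalAt W x
      ≡⟨ cong (_+ offDiagonalAt W x) (cong₂ _+_ row-sum column-sum) ⟩
    (R + R) + offDiagonalAt W x ≡⟨ cong (λ t → (R + t) + offDiagonalAt W x) (sym (+-identityʳ R)) ⟩
    2 * R + offDiagonalAt W x ∎
  where
  open ≡-Reasoning
  R = ∑ (λ y → W x y)
  row column rest : Fin k → Fin k → ℕ
  row z y = if z == x then W z y else 0
  column z y = if z == x then 0 else (if y == x then W z y else 0)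
  rest z y = if (z == x) ∨ (y == x) then 0 else W z y
  parts : ∀ z y → W z y ≡ (row z y + column z y) + rest z y
  parts z y with z == x | y == x
  ... | true | _ = sym (trans (+-identityʳ _) (+-identityʳ _))
  ... | false | true = sym (+-identityʳ _)
  ... | false | false = refl
  row-sum : ∑ (λ z → ∑ (λ y → row z y)) ≡ R
  row-sum = trans (∑-cong pull) (∑-delta x (λ z → ∑ (λ y → W z y)))
    where
    pull : ∀ z → ∑ (λ y → row z y) ≡ (if z == x then ∑ (λ y → W z y) else 0)
    pull z with z == x
    ... | true = refl
    ... | false = ∑-zeros {k}
  column-sum : ∑ (λ z → ∑ (λ y → column z y)) ≡ R
  column-sum = trans (∑-cong pull) (∑-cong (λ z → symm z x))
    where
    pull : ∀ z → ∑ (λ y → column z y) ≡ W z x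
    pull z with z F.≟ x
    ... | yes refl = trans (∑-zeros {k}) (sym diag)
    ... | no _ = ∑-delta x (λ y → W z y)

offDiagonal≡0 : ∀ {k} (W : Fin k → Fin k → ℕ) x → offDiagonalAt W x ≡ 0 →
  ∀ z y → ¬ z ≡ x → ¬ y ≡ x → W z y ≡ 0
offDiagonal≡0 W x zero-sum z y z≢x y≢x =
  trans (sym (cong₂ (λ a b → if a ∨ b then 0 else W z y) (==-no z x z≢x) (==-no y x y≢x)))
    (∑≡0⇒pointwise _ (∑≡0⇒pointwise _ zero-sum z) y)

⊆-and-≥⇒≡ : ∀ {k} (S T : Fin k → Fin k → Bool) → (∀ p q → T p q ≡ true → S p q ≡ true) →
  ordered S ≤ ordered T → ∀ p q → S p q ≡ T p q
⊆-and-≥⇒≡ S T T⊆S S≤T p q = b2n-injective (sym (∑-tight _ _ (pointwise p) (≤-reflexive (sym row)) q))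
  where
  b2n-injective : ∀ {a b} → b2n a ≡ b2n b → a ≡ b
  b2n-injective {true} {true} _ = refl
  b2n-injective {false} {false} _ = refl
  pointwise : ∀ p q → b2n (T p q) ≤ b2n (S p q)
  pointwise p q with bool-cases (T p q)
  ... | inj₁ e rewrite e | T⊆S p q e = ≤-refl
  ... | inj₂ e rewrite e = z≤n
  row = ∑-tight _ _ (λ p → ∑-mono (pointwise p)) S≤T p

closed⇒same-side : ∀ {k} (R : Fin k → Fin k → Bool) (X : Fin k → Bool) → Closed R X →
  (∀ p q → R p q ≡ R q p) → ∀ p q → R p q ≡ true → X p ≡ X q
closed⇒same-side R X cl symm p q r with bool-cases (X p) | bool-cases (X q)
... | inj₁ a | _ = trans a (sym (cl p q r a))
... | inj₂ a | inj₁ b = ⊥-elim (true≢false (trans (sym (cl q p (trans (sym (symm p q)) r) b)) a))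
... | inj₂ a | inj₂ b = trans a (sym b)

three≤order : ∀ m δ → suc m ≤ 2 * δ → δ + 1 ≤ m → 3 ≤ m
three≤order m δ m<2δ δ<m = +-cancelˡ-≤ m 3 m
  (≤-trans (≤-reflexive (shift m)) (≤-trans (+-monoˡ-≤ 2 m<2δ)
    (≤-trans (≤-reflexive (twice δ)) (≤-trans (*-monoʳ-≤ 2 δ<m) (≤-reflexive (double m))))))
  where
  shift : ∀ m → m + 3 ≡ suc m + 2
  shift = solve-∀
  twice : ∀ δ → 2 * δ + 2 ≡ 2 * (δ + 1)
  twice = solve-∀
  double : ∀ m → 2 * m ≡ m + m
  double = solve-∀

two-vertices⇒K₂ : ∀ {n} (G : Graph n) (x y : Fin n) → ¬ y ≡ x → adj G x y ≡ true →
  (∀ z → (z ≡ x) ⊎ (z ≡ y)) → IsK2 G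
two-vertices⇒K₂ {n} G x y y≢x x~y x-or-y = ≤-antisym n≤2 n≥2 , all-adjacent
  where
  to2 : Fin n → Fin 2
  to2 v = if v == x then F.zero else F.suc F.zero
  to2-x : to2 x ≡ F.zero
  to2-x rewrite ==-refl x = refl
  to2-y : to2 y ≡ F.suc F.zero
  to2-y rewrite ==-no y x y≢x = refl
  to2-injective : ∀ {a b} → to2 a ≡ to2 b → a ≡ b
  to2-injective {a} {b} e with x-or-y a | x-or-y b
  ... | inj₁ refl | inj₁ refl = refl
  ... | inj₂ refl | inj₂ refl = refl
  ... | inj₁ refl | inj₂ refl = ⊥-elim (FP.0≢1+n (trans (sym to2-x) (trans e to2-y)))
  ... | inj₂ refl | inj₁ refl = ⊥-elim (FP.0≢1+n (trans (sym to2-x) (trans (sym e) to2-y)))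
  n≤2 : n ≤ 2
  n≤2 = FP.injective⇒≤ {f = to2} to2-injective
  from2 : Fin 2 → Fin n
  from2 F.zero = x
  from2 (F.suc F.zero) = y
  from2-injective : ∀ {a b} → from2 a ≡ from2 b → a ≡ b
  from2-injective {F.zero} {F.zero} _ = refl
  from2-injective {F.suc F.zero} {F.suc F.zero} _ = refl
  from2-injective {F.zero} {F.suc F.zero} e = ⊥-elim (y≢x (sym e))
  from2-injective {F.suc F.zero} {F.zero} e = ⊥-elim (y≢x e)
  n≥2 : 2 ≤ n
  n≥2 = FP.injective⇒≤ {f = from2} from2-injective
  all-adjacent : ∀ a b → ⌊ a F.≟ b ⌋ ≡ false → adj G a b ≡ true
  all-adjacent a b e with x-or-y a | x-or-y b
  ... | inj₁ refl | inj₂ refl = x~y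
  ... | inj₂ refl | inj₁ refl = trans (adj-sym G a b) x~y
  ... | inj₁ refl | inj₁ refl = ⊥-elim (true≢false (trans (sym (==-refl a)) e))
  ... | inj₂ refl | inj₂ refl = ⊥-elim (true≢false (trans (sym (==-refl a)) e))

Exception : ∀ {n m} → Graph n → Graph m → Set
Exception G H = IsK2 G × Σ ℕ (λ l → (1 ≤ l) × (H ≅ JoinGraph l))

module MinimumCut {n m : ℕ} (G : Graph n) (H : Graph m) (dense : MinDegMoreThanHalf H)
  (S : EdgeSet (G ×ᵍ H)) (minimum : IsMinEdgeCut (G ×ᵍ H) S) where
  open Product G H
  open CrossingCounts H

  private
    split = Reachability.disconnected⇒closed-split (removeEdges GH S) (proj₁ minimum)

  X : Fin (n * m) → Bool
  X = proj₁ split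

  p₀ q₀ : Fin (n * m)
  p₀ = proj₁ (proj₁ (proj₂ split))
  q₀ = proj₁ (proj₁ (proj₂ (proj₂ split)))

  X-p₀ : X p₀ ≡ true
  X-p₀ = proj₂ (proj₁ (proj₂ split))

  X-q₀ : X q₀ ≡ false
  X-q₀ = proj₂ (proj₁ (proj₂ (proj₂ split)))

  X-closed : Closed (removeEdges GH S) X
  X-closed = proj₂ (proj₂ (proj₂ split))

  u₀ : Fin m
  u₀ = coordH p₀

  u-min : Fin m
  u-min = proj₁ (argmin deg∑ u₀)

  δ : ℕ
  δ = deg∑ u-min

  δ≤deg : ∀ u → δ ≤ deg∑ u
  δ≤deg = proj₂ (argmin deg∑ u₀)

  m<2δ : suc m ≤ 2 * δ
  m<2δ = subst (λ z → suc m ≤ 2 * z) (deg-∑ H u-min) (dense u-min)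

  3≤m : 3 ≤ m
  3≤m = three≤order m δ m<2δ (deg∑<m u-min)

  open AboveHalf δ δ≤deg m<2δ 3≤m public

  -- Minimality: S ⊇ ∂X because X is closed in G × H − S, and ∂X is itself a cut,
  -- so S = ∂X.
  S≡∂X : ∀ p q → mem S p q ≡ mem (boundary X) p q
  S≡∂X = ⊆-and-≥⇒≡ (mem S) (mem (boundary X)) ∂X⊆S
    (size≤⇒ordered≤ S (boundary X) (proj₂ minimum (boundary X) (boundary-cut X p₀ q₀ X-p₀ X-q₀)))
    where
    symmetric : ∀ p q → removeEdges GH S p q ≡ removeEdges GH S q p
    symmetric p q = cong₂ (λ a b → a ∧ not b) (prod-sym G H p q) (mem-sym S p q)
    ∂X⊆S : ∀ p q → mem (boundary X) p q ≡ true → mem S p q ≡ true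
    ∂X⊆S p q e with bool-cases (mem S p q)
    ... | inj₁ s = s
    ... | inj₂ s = ⊥-elim (xor-true (X p) (X q) (∧-elimʳ e)
                     (closed⇒same-side (removeEdges GH S) X X-closed symmetric p q kept))
      where
      kept : removeEdges GH S p q ≡ true
      kept = trans (cong (λ z → prodAdj G H p q ∧ not z) s) (trans (BP.∧-identityʳ _) (∧-elimˡ e))

  -- The contribution of the G-edge xy to |S|.
  W : Fin n → Fin n → ℕ
  W x y = b2n (adj G x y) * cross (fibre X x) (fibre X y)

  ordered-S : ordered (mem S) ≡ ∑ (λ x → ∑ (λ y → W x y))
  ordered-S = trans (∑-cong (λ p → ∑-cong (λ q → cong b2n (S≡∂X p q)))) (ordered-boundary X)

  W-sym : ∀ x y → W x y ≡ W y x
  W-sym x y = cong₂ _*_ (cong b2n (adj-sym G x y)) (sym (cross-sym (fibre X x) (fibre X y)))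

  W-diag : ∀ x → W x x ≡ 0
  W-diag x = cong (λ b → b2n b * cross (fibre X x) (fibre X x)) (adj-irr G x)

  -- Comparison with the star at (z, u-min), a cut whenever the fibre over z is mixed.
  star-bound : ∀ z → Mixed (fibre X z) → size S ≤ deg G z * δ
  star-bound z ((ut , et) , (uf , ef)) =
    ≤-trans (proj₂ minimum (Star.star GH w) (Star.star-cut GH w w' w'≢w))
      (≤-reflexive (trans (Star.size-star GH w) (trans (deg-product z u-min) (cong (deg G z *_) (deg-∑ H u-min)))))
    where
    w = pair z u-min
    other : Σ (Fin (n * m)) λ w' → ¬ w' ≡ w
    other with pair z ut F.≟ w
    ... | no ne = pair z ut , ne
    ... | yes e = pair z uf , λ e' → true≢false (trans (sym et) (trans (cong X (trans e (sym e'))) ef))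
    w' = proj₁ other
    w'≢w = proj₂ other

  Conclusion : Set
  Conclusion = Σ (EdgeSet G) (λ S₀ → IsMinEdgeCut G S₀ × InducedBy H S S₀)
               ⊎ Σ (Fin (n * m)) (λ w → IsStarAt GH S w)

  -- Case 1: every vertex of G that has a neighbour has a constant fibre.  Then S
  -- is induced by the boundary in G of the layer Y = X ∩ (V(G) × {u₀}).
  module ConstantFibres (constant : ∀ x → (∃ λ y → adj G x y ≡ true) → ¬ Mixed (fibre X x)) where

    Y : Fin n → Bool
    Y x = X (pair x u₀)

    fibre-constant : ∀ x y → adj G x y ≡ true → ∀ u → X (pair x u) ≡ Y x
    fibre-constant x y e u with classify (fibre X x)
    ... | empty h = trans (h u) (sym (h u₀))
    ... | full h = trans (h u) (sym (h u₀))
    ... | mixed h = ⊥-elim (constant x (y , e) h)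

    ∂Y : EdgeSet G
    ∂Y = record
      { mem = λ x y → adj G x y ∧ (Y x xor Y y)
      ; mem-sym = λ x y → cong₂ _∧_ (adj-sym G x y) (BP.xor-comm (Y x) (Y y))
      ; mem-sub = λ x y e → ∧-elimˡ e }

    X-coords : ∀ p → X p ≡ X (pair (coordG p) (coordH p))
    X-coords p = cong X (sym (pair-coords p))

    S-induced : ∀ p q → mem S p q ≡ (mem ∂Y (coordG p) (coordG q) ∧ adj H (coordH p) (coordH q))
    S-induced p q = trans (S≡∂X p q) in-coordinates
      where
      in-coordinates : (prodAdj G H p q ∧ (X p xor X q)) ≡ (mem ∂Y (coordG p) (coordG q) ∧ adj H (coordH p) (coordH q))
      in-coordinates with bool-cases (adj G (coordG p) (coordG q))
      ... | inj₂ e rewrite e = refl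
      ... | inj₁ e rewrite e | X-coords p | X-coords q | fibre-constant (coordG p) (coordG q) e (coordH p)
                          | fibre-constant (coordG q) (coordG p) (trans (adj-sym G (coordG q) (coordG p)) e) (coordH q) =
            BP.∧-comm (adj H (coordH p) (coordH q)) _

    -- Y mixed: ∂Y is a cut of G, and it is minimum because induced edge sets
    -- scale ordered counts by the positive factor ordered-H.
    induced-by-∂Y : ∀ x₁ x₂ → Y x₁ ≡ true → Y x₂ ≡ false → Conclusion
    induced-by-∂Y x₁ x₂ e₁ e₂ = inj₁ (∂Y , (∂Y-cut , ∂Y-minimum) , S-induced)
      where
      ∂Y-cut : IsEdgeCut G ∂Y
      ∂Y-cut = closed⇒disconnected _ Y closed x₁ x₂ e₁ e₂
        where
        closed : ∀ p q → removeEdges G ∂Y p q ≡ true → Y p ≡ true → Y q ≡ true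
        closed p q r yp with bool-cases (adj G p q) | bool-cases (Y p xor Y q)
        ... | _ | inj₂ x = trans (sym (xor-false (Y p) (Y q) x)) yp
        ... | inj₁ a | inj₁ x rewrite a | x = ⊥-elim (true≢false (sym r))
        ... | inj₂ a | inj₁ x rewrite a = ⊥-elim (true≢false (sym r))
      ordered-H≥1 : 1 ≤ ordered-H
      ordered-H≥1 = ≤-trans δ≥1 (∑-point (λ u → ∑ (λ v → b2n (adj H u v))) u-min)
      ordered-S≡ : ordered (mem S) ≡ ordered (mem ∂Y) * ordered-H
      ordered-S≡ = trans (∑-cong (λ p → ∑-cong (λ q → cong b2n (S-induced p q)))) (ordered-induced ∂Y)
      cancel : ∀ a b c → 1 ≤ c → a * c ≤ b * c → a ≤ b
      cancel a b (suc c) _ le = *-cancelʳ-≤ a b (suc c) le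
      ∂Y-minimum : ∀ T → IsEdgeCut G T → size ∂Y ≤ size T
      ∂Y-minimum T cut-T = ordered≤⇒size≤ ∂Y T (cancel _ _ ordered-H ordered-H≥1
        (subst₂ _≤_ ordered-S≡ (ordered-induced T)
          (size≤⇒ordered≤ S (induced T) (proj₂ minimum (induced T) (induced-cut u₀ T cut-T)))))

    S-empty : (∀ x y → Y x ≡ Y y) → ∀ p q → mem S p q ≡ false
    S-empty same p q rewrite S-induced p q | same (coordG p) (coordG q) | BP.xor-same (Y (coordG q)) =
      cong (_∧ adj H (coordH p) (coordH q)) (BP.∧-zeroʳ _)

    isolated : ∀ x a b → X (pair x a) ≡ true → X (pair x b) ≡ false → ∀ y → adj G x y ≡ false
    isolated x a b ea eb y with bool-cases (adj G x y)
    ... | inj₂ e = e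
    ... | inj₁ e = ⊥-elim (constant x (y , e) ((a , ea) , (b , eb)))

    -- Y constant: S = ∅ and G has an isolated vertex x.  Either G has a second vertex,
    -- so ∅ is a minimum cut of G inducing S, or G = K₁ and S = ∅ is the star at p₀.
    with-isolated-vertex : (∀ x y → Y x ≡ Y y) → ∀ x → (∀ y → adj G x y ≡ false) → Conclusion
    with-isolated-vertex same x lonely with FP.any? (λ y → ¬? (y F.≟ x))
    ... | yes (y , y≢x) = inj₁ (noEdges G , noEdges-minimum G (_== x) closed x y (==-refl x) (==-no y x y≢x) ,
                                 λ p q → S-empty same p q)
      where
      closed : ∀ a b → adj G a b ≡ true → (a == x) ≡ true → (b == x) ≡ true
      closed a b e ea with a F.≟ x
      ... | yes refl = ⊥-elim (true≢false (trans (sym e) (lonely b)))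
      closed a b e () | no _
    ... | no only-x = inj₂ (p₀ , λ p q → trans (S-empty same p q) (sym (cong (_∧ ((p == p₀) ∨ (q == p₀))) (no-edges p q))))
      where
      everything-is-x : ∀ y → y ≡ x
      everything-is-x y with y F.≟ x
      ... | yes e = e
      ... | no ne = ⊥-elim (only-x (y , ne))
      no-edges : ∀ p q → prodAdj G H p q ≡ false
      no-edges p q = trans (cong (λ z → adj G z (coordG q) ∧ adj H (coordH p) (coordH q))
                              (trans (everything-is-x (coordG p)) (sym (everything-is-x (coordG q)))))
                       (cong (_∧ adj H (coordH p) (coordH q)) (adj-irr G (coordG q)))

    conclusion : Conclusion
    conclusion with classify Y
    ... | mixed ((x₁ , e₁) , (x₂ , e₂)) = induced-by-∂Y x₁ x₂ e₁ e₂
    ... | empty none = with-isolated-vertex (λ x y → trans (none x) (sym (none y))) (coordG p₀)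
          (isolated (coordG p₀) (coordH p₀) u₀ (trans (sym (X-coords p₀)) X-p₀) (none (coordG p₀)))
    ... | full all = with-isolated-vertex (λ x y → trans (all x) (sym (all y))) (coordG q₀)
          (isolated (coordG q₀) u₀ (coordH q₀) (all (coordG q₀)) (trans (sym (X-coords q₀)) X-q₀))

  -- Every G-edge at x
  -- contributes at least δ to |S| while the star at (x, u-min) has size deg(x)·δ,
  -- so every edge at x contributes exactly δ and no other edge contributes.
  module MixedFibre (x : Fin n) (mixed-x : Mixed (fibre X x)) (y₁ : Fin n) (x~y₁ : adj G x y₁ ≡ true) where

    A : Fin m → Bool
    A = fibre X x

    row : ℕ
    row = ∑ (λ y → W x y)

    off : ℕ
    off = offDiagonalAt W x

    ordered-S-around-x : ordered (mem S) ≡ 2 * row + off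
    ordered-S-around-x = trans ordered-S (∑∑-around W x W-sym (W-diag x))

    row-lower : ∀ y → b2n (adj G x y) * δ ≤ W x y
    row-lower y with bool-cases (adj G x y)
    ... | inj₁ e rewrite e = +-monoˡ-≤ 0 (cross≥δ A (fibre X y) mixed-x)
    ... | inj₂ e rewrite e = z≤n

    deg·δ : ∑ (λ y → b2n (adj G x y) * δ) ≡ deg G x * δ
    deg·δ = trans (∑-*ʳ δ _) (cong (_* δ) (sym (deg-∑ G x)))

    row≥ : deg G x * δ ≤ row
    row≥ = subst (_≤ row) deg·δ (∑-mono row-lower)

    upper : 2 * row + off ≤ 2 * (deg G x * δ)
    upper = subst (_≤ 2 * (deg G x * δ)) (trans (sym (ordered≡2*size S)) ordered-S-around-x)
              (*-monoʳ-≤ 2 (star-bound x mixed-x))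

    off≡0 : off ≡ 0
    off≡0 = n≤0⇒n≡0 (+-cancelˡ-≤ (2 * row) off 0
              (≤-trans upper (≤-trans (*-monoʳ-≤ 2 row≥) (≤-reflexive (sym (+-identityʳ _))))))

    row≡ : row ≡ deg G x * δ
    row≡ = ≤-antisym (*-cancelˡ-≤ 2 (≤-trans (m≤m+n (2 * row) off) upper)) row≥

    row-tight : ∀ y → adj G x y ≡ true → cross A (fibre X y) ≡ δ
    row-tight y e = sym (trans (sym (+-identityʳ δ)) (trans (subst (λ b → b2n b * δ ≡ b2n b * cross A (fibre X y)) e term)
                                                       (+-identityʳ _)))
      where
      term = ∑-tight (λ y → b2n (adj G x y) * δ) (λ y → W x y) row-lower
               (≤-trans (≤-reflexive row≡) (≤-reflexive (sym deg·δ))) y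

    away-from-x : ∀ z y → ¬ z ≡ x → ¬ y ≡ x → adj G z y ≡ true → cross (fibre X z) (fibre X y) ≡ 0
    away-from-x z y z≢x y≢x e = trans (sym (+-identityʳ _))
      (trans (sym (cong (λ b → b2n b * cross (fibre X z) (fibre X y)) e)) (offDiagonal≡0 W x off≡0 z y z≢x y≢x))

    size-S : size S ≡ deg G x * δ
    size-S = *-cancelˡ-≡ _ _ 2 (trans (sym (ordered≡2*size S))
               (trans ordered-S-around-x (trans (cong (2 * row +_) off≡0) (trans (+-identityʳ _) (cong (2 *_) row≡)))))

    deg-x≥1 : 1 ≤ deg G x
    deg-x≥1 = subst (1 ≤_) (sym (deg-∑ G x)) (≤-trans (≤-reflexive (cong b2n (sym x~y₁))) (∑-point (λ y → b2n (adj G x y)) y₁))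

    ordered-S≥2δ : 2 * δ ≤ ordered (mem S)
    ordered-S≥2δ = subst (2 * δ ≤_) (sym ordered-S-around-x)
      (≤-trans (*-monoʳ-≤ 2 (≤-trans (≤-trans (≤-reflexive (sym (*-identityˡ δ))) (*-monoˡ-≤ δ deg-x≥1)) row≥))
               (m≤m+n _ off))

    -- Subcase 2a: a neighbour y of x also has a mixed fibre.  Then x and y have no
    -- other neighbours, {x, y} is all of G (otherwise ∅ would be a cut of G and S
    -- would be empty), and cross A X_y = δ makes H the join graph.
    module MixedNeighbour (y : Fin n) (x~y : adj G x y ≡ true) (mixed-y : Mixed (fibre X y)) where

      y≢x : ¬ y ≡ x
      y≢x e = true≢false (trans (sym x~y) (trans (cong (adj G x) e) (adj-irr G x)))

      y-only-x : ∀ z → ¬ z ≡ x → adj G y z ≡ false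
      y-only-x z z≢x with bool-cases (adj G y z)
      ... | inj₂ e = e
      ... | inj₁ e = ⊥-elim (<⇒≱ δ≥1 (≤-trans (cross≥δ (fibre X y) (fibre X z) mixed-y)
                                      (≤-reflexive (away-from-x y z y≢x z≢x e))))

      deg-y≤1 : deg G y ≤ 1
      deg-y≤1 = subst (_≤ 1) (sym (deg-∑ G y))
        (≤-trans (∑-mono only-x) (≤-reflexive (count-singleton x)))
        where
        only-x : ∀ z → b2n (adj G y z) ≤ b2n (z == x)
        only-x z with z F.≟ x
        ... | yes _ = b2n≤1 _
        ... | no z≢x rewrite y-only-x z z≢x = z≤n

      deg-x≤1 : deg G x ≤ 1
      deg-x≤1 = *δ≤δ⇒≤1 (deg G x) (≤-trans (≤-reflexive (sym size-S))
                  (≤-trans (star-bound y mixed-y) (≤-trans (*-monoˡ-≤ δ deg-y≤1) (≤-reflexive (+-identityʳ δ)))))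

      x-only-y : ∀ z → ¬ z ≡ y → adj G x z ≡ false
      x-only-y z z≢y with bool-cases (adj G x z)
      ... | inj₂ e = e
      ... | inj₁ e = ⊥-elim (<⇒≱ (s≤s (s≤s z≤n)) (≤-trans two deg-x≤1))
        where
        two : 2 ≤ deg G x
        two = subst (2 ≤_) (sym (deg-∑ G x)) (subst (_≤ ∑ (λ w → b2n (adj G x w))) (cong₂ (λ a b → b2n a + b2n b) x~y e)
                (∑-two (λ w → b2n (adj G x w)) y z (λ e' → z≢y (sym e'))))

      adjacent-to-x : ∀ b → adj G x b ≡ true → b ≡ y
      adjacent-to-x b e with b F.≟ y
      ... | yes p = p
      ... | no b≢y = ⊥-elim (true≢false (trans (sym e) (x-only-y b b≢y)))

      adjacent-to-y : ∀ b → adj G y b ≡ true → b ≡ x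
      adjacent-to-y b e with b F.≟ x
      ... | yes p = p
      ... | no b≢x = ⊥-elim (true≢false (trans (sym e) (y-only-x b b≢x)))

      ends : Fin n → Bool
      ends v = (v == x) ∨ (v == y)

      x∈ends : ∀ b → b ≡ x → ends b ≡ true
      x∈ends b refl = cong (_∨ (b == y)) (==-refl b)

      y∈ends : ∀ b → b ≡ y → ends b ≡ true
      y∈ends b refl = trans (cong ((b == x) ∨_) (==-refl b)) (BP.∨-zeroʳ _)

      ends-closed : Closed (adj G) ends
      ends-closed a b e a∈ with a F.≟ x
      ... | yes refl = y∈ends b (adjacent-to-x b e)
      ... | no _ with a F.≟ y
      ... | yes refl = x∈ends b (adjacent-to-y b e)
      ... | no _ = ⊥-elim (true≢false (sym a∈))

      -- A third vertex would make ∅ a cut of G, inducing an empty cut of G × H.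
      no-third-vertex : ∀ z → ¬ z ≡ x → ¬ z ≡ y → ⊥
      no-third-vertex z z≢x z≢y = <⇒≱ (≤-trans (s≤s z≤n) (*-monoʳ-≤ 2 δ≥1))
        (≤-trans ordered-S≥2δ (≤-trans S≤∅ (≤-reflexive ordered-∅)))
        where
        ∅-cut = noEdges-minimum G ends ends-closed x z (x∈ends x refl) (cong₂ _∨_ (==-no z x z≢x) (==-no z y z≢y))
        S≤∅ : ordered (mem S) ≤ ordered (mem (induced (noEdges G)))
        S≤∅ = size≤⇒ordered≤ S (induced (noEdges G))
                (proj₂ minimum (induced (noEdges G)) (induced-cut u₀ (noEdges G) (proj₁ ∅-cut)))
        ordered-∅ : ordered (mem (induced (noEdges G))) ≡ 0
        ordered-∅ = trans (ordered-induced (noEdges G))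
                      (cong (_* ordered-H) (trans (ordered≡2*size (noEdges G)) (cong (2 *_) (size-noEdges G))))

      G≡K₂ : IsK2 G
      G≡K₂ = two-vertices⇒K₂ G x y y≢x x~y x-or-y
        where
        x-or-y : ∀ z → (z ≡ x) ⊎ (z ≡ y)
        x-or-y z with z F.≟ x
        ... | yes p = inj₁ p
        ... | no z≢x with z F.≟ y
        ... | yes p = inj₂ p
        ... | no z≢y = ⊥-elim (no-third-vertex z z≢x z≢y)

      exception : Exception G H
      exception = G≡K₂ , joinStructure⇒≅join H (proj₂ (cross-vs-mixed A (fibre X y) mixed-x mixed-y) (row-tight y x~y))

    -- Write S = ∂Z with Z = X or
    -- its complement chosen so that Z_x = {u} is a single vertex; then the
    -- neighbouring fibres of Z are empty and S is the star at (x, u).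
    module StarShape (Z : Fin (n * m) → Bool) (S≡∂Z : ∀ p q → mem S p q ≡ mem (boundary Z) p q)
      (|Z_x|≡1 : count (fibre Z x) ≡ 1) (mixed-Z_x : Mixed (fibre Z x))
      (row-Z : ∀ y → adj G x y ≡ true → cross (fibre Z x) (fibre Z y) ≡ δ)
      (neighbours-Z : ∀ y → adj G x y ≡ true → ¬ Mixed (fibre Z y))
      (away-Z : ∀ z y → ¬ z ≡ x → ¬ y ≡ x → adj G z y ≡ true → cross (fibre Z z) (fibre Z y) ≡ 0) where

      u : Fin m
      u = proj₁ (proj₁ mixed-Z_x)

      w : Fin (n * m)
      w = pair x u

      Z_x≡single-u : ∀ a → Z (pair x a) ≡ (a == u)
      Z_x≡single-u a with a F.≟ u
      ... | yes refl = proj₂ (proj₁ mixed-Z_x)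
      ... | no a≢u with bool-cases (fibre Z x a)
      ... | inj₂ e = e
      ... | inj₁ e = ⊥-elim (<⇒≱ (s≤s (s≤s z≤n)) (≤-trans (subst (_≤ count (fibre Z x))
                        (cong₂ (λ a b → b2n a + b2n b) (proj₂ (proj₁ mixed-Z_x)) e)
                        (∑-two (λ w → b2n (fibre Z x w)) u a (λ e' → a≢u (sym e')))) (≤-reflexive |Z_x|≡1)))

      -- A full neighbouring fibre would give cross = degSum (∁ Z_x) ≥ 2δ.
      neighbour-empty : ∀ y → adj G x y ≡ true → ∀ b → Z (pair y b) ≡ false
      neighbour-empty y x~y b with classify (fibre Z y)
      ... | empty h = h b
      ... | mixed h = ⊥-elim (neighbours-Z y x~y h)
      ... | full h = ⊥-elim (<⇒≱ δ≥1 (+-cancelˡ-≤ δ δ 0 (≤-trans 2δ≤cross (≤-reflexive (trans (row-Z y x~y) (sym (+-identityʳ δ)))))))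
        where
        A' = fibre Z x
        |∁A'|≥2 : 2 ≤ count (∁ A')
        |∁A'|≥2 = +-cancelˡ-≤ 1 2 _ (≤-trans 3≤m (≤-reflexive (sym (trans (cong (_+ count (∁ A')) (sym |Z_x|≡1)) (count-∁ A')))))
        2δ≤cross : δ + δ ≤ cross A' (fibre Z y)
        2δ≤cross = ≤-trans (≤-reflexive (cong (δ +_) (sym (+-identityʳ δ)))) (≤-trans (*-monoˡ-≤ δ |∁A'|≥2)
                     (≤-trans (degSum≥ δ δ≤deg (∁ A'))
                       (≤-reflexive (trans (sym (cross-empty (∁ A') (∁ (fibre Z y)) (∁-full (fibre Z y) h))) (cross-∁ A' (fibre Z y))))))

      crosses⇔meets-w : ∀ a i b j → adj G a b ≡ true → adj H i j ≡ true →
        (Z (pair a i) xor Z (pair b j)) ≡ ((pair a i == w) ∨ (pair b j == w))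
      crosses⇔meets-w a i b j ag ah with a F.≟ x | b F.≟ x
      ... | yes refl | yes refl = ⊥-elim (true≢false (trans (sym ag) (adj-irr G a)))
      ... | yes refl | no b≢a rewrite pair-== a i x u | pair-== b j x u | ==-refl a | ==-no b a b≢a
                                    | Z_x≡single-u i | neighbour-empty b ag j =
            trans (BP.xor-identityʳ _) (sym (BP.∨-identityʳ _))
      ... | no a≢b | yes refl rewrite pair-== a i x u | pair-== b j x u | ==-refl b | ==-no a b a≢b
                                    | Z_x≡single-u j | neighbour-empty a (trans (adj-sym G b a) ag) i = refl
      ... | no a≢x | no b≢x rewrite pair-== a i x u | pair-== b j x u | ==-no a x a≢x | ==-no b x b≢x = unchanged
        where
        term≡0 : b2n (adj H i j ∧ (Z (pair a i) xor Z (pair b j))) ≡ 0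
        term≡0 = ∑≡0⇒pointwise _ (∑≡0⇒pointwise _ (away-Z a b a≢x b≢x ag) i) j
        unchanged : (Z (pair a i) xor Z (pair b j)) ≡ false
        unchanged with bool-cases (Z (pair a i) xor Z (pair b j))
        ... | inj₂ e = e
        ... | inj₁ e = ⊥-elim (1+n≢0 (trans (sym (cong₂ (λ a b → b2n (a ∧ b)) ah e)) term≡0))

      ∂Z-pointwise : ∀ a i b j →
        mem (boundary Z) (pair a i) (pair b j) ≡ (prodAdj G H (pair a i) (pair b j) ∧ ((pair a i == w) ∨ (pair b j == w)))
      ∂Z-pointwise a i b j rewrite prodAdj-combine G H a i b j with bool-cases (adj G a b) | bool-cases (adj H i j)
      ... | inj₂ e | _ rewrite e = refl
      ... | inj₁ e | inj₂ e' rewrite e | e' = refl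
      ... | inj₁ e | inj₁ e' rewrite e | e' = crosses⇔meets-w a i b j e e'

      is-star : IsStarAt GH S w
      is-star p q = trans (S≡∂Z p q)
        (subst₂ (λ p' q' → mem (boundary Z) p' q' ≡ (prodAdj G H p' q' ∧ ((p' == w) ∨ (q' == w))))
          (pair-coords p) (pair-coords q) (∂Z-pointwise (coordG p) (coordH p) (coordG q) (coordH q)))

    star : ¬ Exception G H → Σ (Fin (n * m)) (λ w → IsStarAt GH S w)
    star not-exceptional with FP.any? (λ y → (adj G x y BP.≟ true) ×-dec Mixed? (fibre X y))
    ... | yes (y , x~y , mixed-y) = ⊥-elim (not-exceptional (MixedNeighbour.exception y x~y mixed-y))
    ... | no no-mixed with classify (fibre X y₁)
    ... | mixed h = ⊥-elim (no-mixed (y₁ , x~y₁ , h))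
    ... | empty h = Z-star.w , Z-star.is-star
      where
      module Z-star = StarShape X S≡∂X (proj₂ (cross-vs-empty A (fibre X y₁) mixed-x h) (row-tight y₁ x~y₁)) mixed-x
                        row-tight (λ y x~y mixed-y → no-mixed (y , x~y , mixed-y)) away-from-x
    ... | full h = Z-star.w , Z-star.is-star
      where
      S≡∂∁X : ∀ p q → mem S p q ≡ mem (boundary (∁ X)) p q
      S≡∂∁X p q = trans (S≡∂X p q) (cong (prodAdj G H p q ∧_) (sym (xor-not (X p) (X q))))
      unmixed : ∀ y → adj G x y ≡ true → ¬ Mixed (fibre (∁ X) y)
      unmixed y x~y mixed-y = no-mixed (y , x~y , Mixed-∁⁻¹ (fibre X y) mixed-y)
      module Z-star = StarShape (∁ X) S≡∂∁X (proj₂ (cross-vs-full A (fibre X y₁) mixed-x h) (row-tight y₁ x~y₁))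
                        (Mixed-∁ A mixed-x)
                        (λ y x~y → trans (cross-∁ A (fibre X y)) (row-tight y x~y))
                        unmixed
                        (λ z y z≢x y≢x e → trans (cross-∁ (fibre X z) (fibre X y)) (away-from-x z y z≢x y≢x e))

theorem2 : ∀ {n m} (G : Graph n) (H : Graph m) →
    MinDegMoreThanHalf H →
    (S : EdgeSet (G ×ᵍ H)) → IsMinEdgeCut (G ×ᵍ H) S →
    ¬ (IsK2 G × Σ ℕ (λ l → (1 ≤ l) × (H ≅ JoinGraph l))) →
    Σ (EdgeSet G) (λ S₀ → IsMinEdgeCut G S₀ × InducedBy H S S₀)
    ⊎ Σ (Fin (n * m)) (λ w → IsStarAt (G ×ᵍ H) S w)
theorem2 G H dense S minimum not-exceptional =
  case FP.any? (λ x → FP.any? (λ y → adj G x y BP.≟ true) ×-dec Mixed? (fibre X x)) of λ where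
    (yes (x , (y , x~y) , mixed-x)) → inj₂ (MixedFibre.star x mixed-x y x~y not-exceptional)
    (no none) → ConstantFibres.conclusion (λ x neighbour mixed-x → none (x , neighbour , mixed-x))
  where
  open MinimumCut G H dense S minimum
  open Product G H
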